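{- Let $k\geq 2$ be an integer and let $G$ be a connected finite simple graph without isolated vertices such that the average $2$-degree satisfies $m_i\leq k$ for every vertex $i\in V(G)$. Then the maximum degree satisfies $$\Delta(G)\leq k^2-k+1.$$ Moreover, the following are equivalent: (i) $\Delta(G)=k^2-k+1$; (ii) $G$ is the tree $T_k$; (iii) $G$ is a pseudo $k$-regular tree; (iv) $G$ has a vertex $j$ with $d_j=m_j=k$ such that all neighbors of $j$, with exactly one exception, have degree $1$.
   Context: For a vertex $i$, $d_i$ is its degree and $m_i=d_i^{ -1}\sum_{j:\, ji\in E(G)} d_j$ is its average $2$-degree. A graph is $k$-harmonic if $m_i=k$ for all vertices $i$, and pseudo $k$-regular if it is $k$-harmonic but not $k$-regular. For $k\geq 2$, $T_k$ is the tree of order $k^3-k^2+k+1$ whose root has degree $k^2-k+1$ and each neighbor of the root has $k-1$ children, all of which are leaves. -}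

module Defs where

open import Data.Nat using (ℕ; zero; suc; _+_; _*_; _∸_; _^_; _⊔_; _≤_; _≤ᵇ_; _<ᵇ_; _≡ᵇ_)
open import Data.Fin using (Fin; toℕ) renaming (zero to fzero; suc to fsuc)
open import Data.Bool using (Bool; true; false; if_then_else_; _∧_; _∨_)
open import Data.List using (List; []; _∷_; _++_; length)
open import Data.List.Relation.Unary.Unique.Propositional using (Unique)
open import Data.Integer using (+_)
open import Data.Rational.Unnormalised using (ℚᵘ; mkℚᵘ; _≃_)
open import Data.Unit using (⊤)
open import Data.Empty using (⊥)
open import Data.Product using (Σ; _×_; _,_)
open import Relation.Binary.PropositionalEquality using (_≡_; _≢_)
open import Function.Definitions using (Bijective)

sumF : ∀ {n} → (Fin n → ℕ) → ℕ
sumF {zero}  f = 0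
sumF {suc n} f = f fzero + sumF (λ i → f (fsuc i))

maxF : ∀ {n} → (Fin n → ℕ) → ℕ
maxF {zero}  f = 0
maxF {suc n} f = f fzero ⊔ maxF (λ i → f (fsuc i))

record Graph (n : ℕ) : Set where
  field
    adj    : Fin n → Fin n → Bool
    sym    : ∀ i j → adj i j ≡ adj j i
    irrefl : ∀ i → adj i i ≡ false
open Graph public

module _ {n : ℕ} (G : Graph n) where

  Adj : Fin n → Fin n → Set
  Adj i j = adj G i j ≡ true

  deg : Fin n → ℕ
  deg i = sumF (λ j → if adj G i j then 1 else 0)

  twoDegSum : Fin n → ℕ
  twoDegSum i = sumF (λ j → if adj G i j then deg j else 0)

  -- average 2-degree m_i = (Σ_{j ~ i} d_j) / d_i  as an unnormalised rational
  -- (mkℚᵘ p q denotes p / (q+1); meaningful when d_i ≥ 1)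
  avg2deg : Fin n → ℚᵘ
  avg2deg i = mkℚᵘ (+ twoDegSum i) (deg i ∸ 1)

  maxDeg : ℕ
  maxDeg = maxF deg

  NoIsolated : Set
  NoIsolated = ∀ i → 1 ≤ deg i

  data Reachable : Fin n → Fin n → Set where
    here : ∀ {i} → Reachable i i
    step : ∀ {i j l} → Adj i j → Reachable j l → Reachable i l

  Connected : Set
  Connected = ∀ i j → Reachable i j

  Chain : List (Fin n) → Set
  Chain []            = ⊤
  Chain (x ∷ [])      = ⊤
  Chain (x ∷ y ∷ xs)  = Adj x y × Chain (y ∷ xs)

  HasCycle : Set
  HasCycle = Σ (Fin n) λ x → Σ (List (Fin n)) λ rest →
               (2 ≤ length rest) × Unique (x ∷ rest) × Chain (x ∷ rest ++ x ∷ [])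

  Acyclic : Set
  Acyclic = HasCycle → ⊥

  IsTree : Set
  IsTree = Connected × Acyclic

  Regular : ℕ → Set
  Regular k = ∀ i → deg i ≡ k

  Harmonic : ℕ → Set
  Harmonic k = ∀ i → avg2deg i ≃ mkℚᵘ (+ k) 0

  PseudoRegular : ℕ → Set
  PseudoRegular k = Harmonic k × (Regular k → ⊥)

-- The tree T_k on vertex set Fin (k^3 - k^2 + k + 1), with a = k^2 - k + 1:
-- vertex 0 is the root; vertices 1..a are the neighbours of the root;
-- neighbour x (1 ≤ x ≤ a) has the k-1 leaf children
-- a + 1 + (x-1)(k-1), ..., a + x(k-1).
TkOrder : ℕ → ℕ
TkOrder k = k ^ 3 ∸ k ^ 2 + k + 1

TkRel : ℕ → ℕ → ℕ → Bool
TkRel k x y =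
  ((x ≡ᵇ 0) ∧ (1 ≤ᵇ y) ∧ (y ≤ᵇ a))
  ∨ ((1 ≤ᵇ x) ∧ (x ≤ᵇ a) ∧ (a + 1 + (x ∸ 1) * (k ∸ 1) ≤ᵇ y) ∧ (y <ᵇ a + 1 + x * (k ∸ 1)))
  where a = k ^ 2 ∸ k + 1

TkAdj : (k : ℕ) → Fin (TkOrder k) → Fin (TkOrder k) → Bool
TkAdj k x y = TkRel k (toℕ x) (toℕ y) ∨ TkRel k (toℕ y) (toℕ x)

IsoTo : ∀ {n m} → Graph n → (Fin m → Fin m → Bool) → Set
IsoTo {n} {m} G H = Σ (Fin n → Fin m) λ f → Bijective _≡_ _≡_ f × (∀ i j → adj G i j ≡ H (f i) (f j))

IsTk : ∀ {n} → ℕ → Graph n → Set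
IsTk k G = IsoTo G (TkAdj k)

module Submission where

-- Write k = m + 1, S_i = Σ_{j~i} d_j, so the hypothesis reads S_i ≤ k·d_i.  Everything rests
-- on counting S_i with one or two neighbours singled out (d_j + d_v ≤ S_j + 1, …).
-- * Bound: adjacent p, v have d_v ≤ m·d_p + 1, and each v has a neighbour of degree ≤ k.
-- * Extremal structure: if d_v = A, the neighbours of v (spokes) have degree k, their other
--   neighbours (tips) are leaves, and by connectivity G is v + spokes + tips.  Such a G is
--   k-harmonic, not regular and acyclic, and numbering centre, spokes and tips by ranks
--   gives an isomorphism onto T_k; this is (i) ⇒ (ii) and (i) ⇒ (iii).
-- * (ii) ⇒ (i): the root of T_k has degree A.  (iii) ⇒ (iv): a longest-path argument finds
--   a twig.  (iv) ⇒ (i): S_j = k² with all but one neighbour leaves forces that one to have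
--   degree A.

module FiniteSums where

  open import Defs using (sumF; maxF)
  open import Data.Nat using (ℕ; zero; suc; _+_; _*_; _≤_; _<_; _⊔_; z≤n; s≤s)
  open import Data.Nat.Properties hiding (_≟_; 0≢1+n)
  open import Data.Fin using (Fin; punchIn; punchOut) renaming (zero to fzero; suc to fsuc)
  open import Data.Fin.Properties using (punchInᵢ≢i; punchOut-injective; injective⇒≤; any?; _≟_; 0≢1+n)
    renaming (suc-injective to fsuc-injective)
  open import Data.Bool using (Bool; true; false; if_then_else_; T)
  open import Data.Vec.Functional using (updateAt)
  open import Data.Vec.Functional.Properties using (updateAt-updates; updateAt-minimal)
  open import Algebra.Properties.Semiring.Sum +-*-semiring
    using (sum; sum-cong-≗; sum-remove; ∑-distrib-+; ∑-comm; *-distribˡ-sum)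
  open import Data.Product using (Σ; ∃; _,_)
  open import Data.Sum using (inj₁; inj₂)
  open import Function using (_∘_; const)
  open import Function.Definitions using (Injective; Surjective)
  open import Function.Consequences.Propositional using (strictlySurjective⇒surjective)
  open import Relation.Nullary using (yes; no; ¬_)
  open import Relation.Binary.PropositionalEquality hiding ([_])
  open import Data.Empty using (⊥-elim)

  [_] : Bool → ℕ
  [ b ] = if b then 1 else 0

  []-mono : ∀ {b b′} → (T b → T b′) → [ b ] ≤ [ b′ ]
  []-mono {false}          _    = z≤n
  []-mono {true} {true}    _    = ≤-refl
  []-mono {true} {false}   b⇒b′ = ⊥-elim (b⇒b′ _)

  []-true : ∀ {b} → T b → [ b ] ≡ 1
  []-true {true} _ = refl

  []-false : ∀ {b} → ¬ T b → [ b ] ≡ 0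
  []-false {false} _    = refl
  []-false {true}  notT = ⊥-elim (notT _)

  []≤1 : ∀ b → [ b ] ≤ 1
  []≤1 false = z≤n
  []≤1 true  = ≤-refl

  -- The sum 'sumF' of the definitions unfolds exactly like the library's 'sum', so the
  -- library's summation laws (linearity, Fubini, removal of a term) transfer to it.
  sumF≡sum : ∀ {n} (f : Fin n → ℕ) → sumF f ≡ sum f
  sumF≡sum {zero}  f = refl
  sumF≡sum {suc n} f = cong (f fzero +_) (sumF≡sum (f ∘ fsuc))

  sum-cong : ∀ {n} {f g : Fin n → ℕ} → (∀ i → f i ≡ g i) → sumF f ≡ sumF g
  sum-cong {f = f} {g} f≗g = trans (sumF≡sum f) (trans (sum-cong-≗ f≗g) (sym (sumF≡sum g)))

  sum-mono : ∀ {n} {f g : Fin n → ℕ} → (∀ i → f i ≤ g i) → sumF f ≤ sumF g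
  sum-mono {zero}  f≤g = z≤n
  sum-mono {suc n} f≤g = +-mono-≤ (f≤g fzero) (sum-mono (f≤g ∘ fsuc))

  sum-+ : ∀ {n} (f g : Fin n → ℕ) → sumF (λ i → f i + g i) ≡ sumF f + sumF g
  sum-+ f g = begin
    sumF (λ i → f i + g i)  ≡⟨ sumF≡sum (λ i → f i + g i) ⟩
    sum (λ i → f i + g i)   ≡⟨ ∑-distrib-+ f g ⟩
    sum f + sum g           ≡⟨ sym (cong₂ _+_ (sumF≡sum f) (sumF≡sum g)) ⟩
    sumF f + sumF g         ∎
    where open ≡-Reasoning

  sum-scale : ∀ {n} (c : ℕ) (f : Fin n → ℕ) → sumF (λ i → c * f i) ≡ c * sumF f
  sum-scale c f = begin
    sumF (λ i → c * f i)  ≡⟨ sumF≡sum (λ i → c * f i) ⟩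
    sum (λ i → c * f i)   ≡⟨ sym (*-distribˡ-sum c f) ⟩
    c * sum f             ≡⟨ cong (c *_) (sym (sumF≡sum f)) ⟩
    c * sumF f            ∎
    where open ≡-Reasoning

  sum-zeros : ∀ {n} → sumF {n} (λ _ → 0) ≡ 0
  sum-zeros {zero}  = refl
  sum-zeros {suc n} = sum-zeros {n}

  sum-ones : ∀ {n} → sumF {n} (λ _ → 1) ≡ n
  sum-ones {zero}  = refl
  sum-ones {suc n} = cong suc (sum-ones {n})

  sum-comm : ∀ {m n} (h : Fin m → Fin n → ℕ) →
             sumF (λ i → sumF (h i)) ≡ sumF (λ j → sumF (λ i → h i j))
  sum-comm h = begin
    sumF (λ i → sumF (h i))             ≡⟨ sumF≡sum (λ i → sumF (h i)) ⟩
    sum (λ i → sumF (h i))              ≡⟨ sum-cong-≗ (λ i → sumF≡sum (h i)) ⟩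
    sum (λ i → sum (h i))               ≡⟨ ∑-comm h ⟩
    sum (λ j → sum (λ i → h i j))       ≡⟨ sum-cong-≗ (λ j → sym (sumF≡sum (λ i → h i j))) ⟩
    sum (λ j → sumF (λ i → h i j))      ≡⟨ sym (sumF≡sum (λ j → sumF (λ i → h i j))) ⟩
    sumF (λ j → sumF (λ i → h i j))     ∎
    where open ≡-Reasoning

  sum-exchange : ∀ {n} (f g : Fin n → ℕ) (u : Fin n) →
                 (∀ i → i ≢ u → f i ≡ g i) → sumF f + g u ≡ sumF g + f u
  sum-exchange {suc n} f g u agree = begin
    sumF f + g u               ≡⟨ cong (_+ g u) (trans (sumF≡sum f) (sum-remove f)) ⟩
    f u + sum (f ∘ punchIn u) + g u
      ≡⟨ cong (λ r → f u + r + g u) (sum-cong-≗ (λ j → agree _ (punchInᵢ≢i u j))) ⟩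
    f u + sum (g ∘ punchIn u) + g u
      ≡⟨ +-comm (f u + _) (g u) ⟩
    g u + (f u + sum (g ∘ punchIn u))
      ≡⟨ cong (g u +_) (+-comm (f u) _) ⟩
    g u + (sum (g ∘ punchIn u) + f u)
      ≡⟨ sym (+-assoc (g u) _ (f u)) ⟩
    g u + sum (g ∘ punchIn u) + f u
      ≡⟨ cong (_+ f u) (sym (trans (sumF≡sum g) (sum-remove g))) ⟩
    sumF g + f u               ∎
    where open ≡-Reasoning

  sum-single : ∀ {n} (f : Fin n → ℕ) (u : Fin n) → (∀ i → i ≢ u → f i ≡ 0) → sumF f ≡ f u
  sum-single {n} f u zero-off = begin
    sumF f                    ≡⟨ sym (+-identityʳ _) ⟩
    sumF f + 0                ≡⟨ sum-exchange f (λ _ → 0) u zero-off ⟩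
    sumF {n} (λ _ → 0) + f u  ≡⟨ cong (_+ f u) (sum-zeros {n}) ⟩
    f u                       ∎
    where open ≡-Reasoning

  sum-update : ∀ {n} (f : Fin n → ℕ) (u : Fin n) (c : ℕ) →
               sumF (updateAt f u (const c)) + f u ≡ sumF f + c
  sum-update f u c =
    trans (sum-exchange _ f u (λ i i≢u → updateAt-minimal i u f i≢u))
          (cong (sumF f +_) (updateAt-updates u f))

  sum-le-exchange : ∀ {n} (f g : Fin n → ℕ) (u : Fin n) → (∀ i → g i ≤ f i) →
                    sumF g + f u ≤ sumF f + g u
  sum-le-exchange f g u g≤f = begin
    sumF g + f u                            ≤⟨ +-monoˡ-≤ (f u) (sum-mono g≤h) ⟩
    sumF (updateAt f u (const (g u))) + f u ≡⟨ sum-update f u (g u) ⟩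
    sumF f + g u                            ∎
    where
      open ≤-Reasoning
      g≤h : ∀ i → g i ≤ updateAt f u (const (g u)) i
      g≤h i with i ≟ u
      ... | yes refl = ≤-reflexive (sym (updateAt-updates u f))
      ... | no  i≢u  = subst (g i ≤_) (sym (updateAt-minimal i u f i≢u)) (g≤f i)

  sum-≥-term : ∀ {n} (f : Fin n → ℕ) (u : Fin n) → f u ≤ sumF f
  sum-≥-term f fzero    = m≤m+n _ _
  sum-≥-term f (fsuc u) = ≤-trans (sum-≥-term (f ∘ fsuc) u) (m≤n+m _ _)

  sum-≥-two : ∀ {n} (f : Fin n → ℕ) (u w : Fin n) → u ≢ w → 1 ≤ f u → 1 ≤ f w → 2 ≤ sumF f
  sum-≥-two f u w u≢w fu≥1 fw≥1 = begin
    1 + 1                                 ≤⟨ +-mono-≤ fw≥1 fu≥1 ⟩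
    f w + f u                             ≡⟨ cong (_+ f u) (sym (updateAt-minimal w u f (u≢w ∘ sym))) ⟩
    updateAt f u (const 0) w + f u        ≤⟨ +-monoˡ-≤ (f u) (sum-≥-term _ w) ⟩
    sumF (updateAt f u (const 0)) + f u   ≡⟨ sum-update f u 0 ⟩
    sumF f + 0                            ≡⟨ +-identityʳ _ ⟩
    sumF f                                ∎
    where open ≤-Reasoning

  sum-positive : ∀ {n} (f : Fin n → ℕ) → 1 ≤ sumF f → Σ (Fin n) λ i → 1 ≤ f i
  sum-positive {suc n} f pos with f fzero in eq
  ... | suc _ = fzero , subst (1 ≤_) (sym eq) (s≤s z≤n)
  ... | zero with sum-positive (f ∘ fsuc) pos
  ...   | i , fi≥1 = fsuc i , fi≥1

  sum-injective : ∀ {m n} (h : Fin m → Fin n) → Injective _≡_ _≡_ h → (φ : Fin n → ℕ) →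
                  sumF (φ ∘ h) ≤ sumF φ
  sum-injective {zero}  h inj φ = z≤n
  sum-injective {suc m} h inj φ = begin
    φ h₀ + sumF (φ ∘ h ∘ fsuc)   ≡⟨ cong (φ h₀ +_) (sum-cong away) ⟩
    φ h₀ + sumF (φ′ ∘ h ∘ fsuc)  ≤⟨ +-monoʳ-≤ (φ h₀) (sum-injective (h ∘ fsuc) (fsuc-injective ∘ inj) φ′) ⟩
    φ h₀ + sumF φ′               ≡⟨ +-comm (φ h₀) _ ⟩
    sumF φ′ + φ h₀               ≡⟨ sum-update φ h₀ 0 ⟩
    sumF φ + 0                   ≡⟨ +-identityʳ _ ⟩
    sumF φ                       ∎
    where
      open ≤-Reasoning
      h₀ : Fin _
      h₀ = h fzero
      φ′ : Fin _ → ℕ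
      φ′ = updateAt φ h₀ (const 0)
      away : ∀ t → φ (h (fsuc t)) ≡ φ′ (h (fsuc t))
      away t = sym (updateAt-minimal _ h₀ φ (0≢1+n ∘ sym ∘ inj))

  max-upper : ∀ {n} (f : Fin n → ℕ) (i : Fin n) → f i ≤ maxF f
  max-upper f fzero    = m≤m⊔n _ _
  max-upper f (fsuc i) = ≤-trans (max-upper (f ∘ fsuc) i) (m≤n⊔m _ _)

  max-least : ∀ {n} (f : Fin n → ℕ) (c : ℕ) → (∀ i → f i ≤ c) → maxF f ≤ c
  max-least {zero}  f c bound = z≤n
  max-least {suc n} f c bound = ⊔-lub (bound fzero) (max-least (f ∘ fsuc) c (bound ∘ fsuc))

  max-attained : ∀ {n} (f : Fin n → ℕ) → 1 ≤ maxF f → Σ (Fin n) λ i → maxF f ≡ f i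
  max-attained {suc n} f pos with ⊔-sel (f fzero) (maxF (f ∘ fsuc))
  ... | inj₁ e = fzero , e
  ... | inj₂ e with max-attained (f ∘ fsuc) (subst (1 ≤_) e pos)
  ...   | i , e′ = fsuc i , trans e e′

  -- An injection between finite sets of the same size is onto: a missed point y
  -- would give an injection Fin n → Fin (n − 1) by punching y out.
  injective⇒onto : ∀ {n} (f : Fin n → Fin n) → Injective _≡_ _≡_ f → ∀ y → ∃ λ x → f x ≡ y
  injective⇒onto {suc n} f inj y with any? (λ x → f x ≟ y)
  ... | yes found = found
  ... | no  miss  = ⊥-elim (<⇒≱ (n<1+n n) (injective⇒≤ punched-inj))
    where
      missed : ∀ x → y ≢ f x
      missed x e = miss (x , sym e)
      punched-inj : Injective _≡_ _≡_ (λ x → punchOut (missed x))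
      punched-inj e = inj (punchOut-injective (missed _) (missed _) e)

  injective⇒surjective : ∀ {m n} → m ≡ n → (f : Fin m → Fin n) → Injective _≡_ _≡_ f → Surjective _≡_ _≡_ f
  injective⇒surjective refl f inj = strictlySurjective⇒surjective (injective⇒onto f inj)

module Neighbourhoods where

  open import Defs using (sumF; Graph; adj; Adj; deg; twoDegSum)
  import Defs
  open FiniteSums
  open import Data.Nat using (ℕ; suc; _+_; _*_; _≤_)
  open import Data.Nat.Properties hiding (_≟_)
  open import Data.Fin using (Fin)
  open import Data.Fin.Properties using (_≟_; any?)
  open import Data.Bool using (Bool; true; false; if_then_else_)
  import Data.Bool as Bool
  open import Data.Vec.Functional using (updateAt)
  open import Data.Vec.Functional.Properties using (updateAt-updates; updateAt-minimal)
  open import Data.Product using (Σ; _×_; _,_)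
  open import Data.Empty using (⊥-elim)
  open import Function using (_∘_; const)
  open import Relation.Nullary using (yes; no; ¬_)
  open import Relation.Nullary.Decidable using (_×-dec_; ¬?)
  open import Relation.Binary.PropositionalEquality hiding ([_])

  module _ {n : ℕ} (G : Graph n) where

    Adj-sym : ∀ {i j} → Adj G i j → Adj G j i
    Adj-sym {i} {j} i~j = trans (Defs.Graph.sym G j i) i~j

    Adj-irrefl : ∀ {i} → ¬ Adj G i i
    Adj-irrefl {i} i~i with trans (sym i~i) (Defs.Graph.irrefl G i)
    ... | ()

    Adj⇒≢ : ∀ {i j} → Adj G i j → i ≢ j
    Adj⇒≢ i~j refl = Adj-irrefl i~j

    ¬Adj⇒false : ∀ {i j} → ¬ Adj G i j → adj G i j ≡ false
    ¬Adj⇒false {i} {j} i≁j with adj G i j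
    ... | true  = ⊥-elim (i≁j refl)
    ... | false = refl

    nbrDeg : Fin n → Fin n → ℕ
    nbrDeg j w = if adj G j w then deg G w else 0

    nbrConst : ℕ → Fin n → Fin n → ℕ
    nbrConst c j w = c * [ adj G j w ]

    sum-nbrConst : ∀ c j → sumF (nbrConst c j) ≡ c * deg G j
    sum-nbrConst c j = sum-scale c (λ w → [ adj G j w ])

    nbrConst-at : ∀ c {j w} → Adj G j w → nbrConst c j w ≡ c
    nbrConst-at c j~w rewrite j~w = *-identityʳ c

    nbrDeg-at : ∀ {j w} → Adj G j w → nbrDeg j w ≡ deg G w
    nbrDeg-at j~w rewrite j~w = refl

    nbrConst≤nbrDeg : ∀ c j → (∀ w → Adj G j w → c ≤ deg G w) → ∀ w → nbrConst c j w ≤ nbrDeg j w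
    nbrConst≤nbrDeg c j low w with adj G j w in j~w
    ... | true  = subst (_≤ deg G w) (sym (*-identityʳ c)) (low w j~w)
    ... | false = ≤-reflexive (*-zeroʳ c)

    neighbour : ∀ i → 1 ≤ deg G i → Σ (Fin n) λ j → Adj G i j
    neighbour i deg≥1 with sum-positive _ deg≥1
    ... | j , term≥1 with adj G i j in i~j
    ...   | true  = j , i~j
    ...   | false = ⊥-elim (<⇒≢ term≥1 refl)

    []-at : ∀ {i j} → Adj G i j → [ adj G i j ] ≡ 1
    []-at i~j rewrite i~j = refl

    deg≥2 : ∀ {i a b} → Adj G i a → Adj G i b → a ≢ b → 2 ≤ deg G i
    deg≥2 {i} i~a i~b a≢b =
      sum-≥-two (λ j → [ adj G i j ]) _ _ a≢b (≤-reflexive (sym ([]-at i~a))) (≤-reflexive (sym ([]-at i~b)))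

    deg1-unique : ∀ {i a b} → deg G i ≡ 1 → Adj G i a → Adj G i b → a ≡ b
    deg1-unique {a = a} {b} deg≡1 i~a i~b with a ≟ b
    ... | yes a≡b = a≡b
    ... | no  a≢b = ⊥-elim (<⇒≱ (≤-reflexive (cong suc deg≡1)) (deg≥2 i~a i~b a≢b))

    twoDeg-lower : ∀ c j → (∀ w → Adj G j w → c ≤ deg G w) → c * deg G j ≤ twoDegSum G j
    twoDeg-lower c j low = subst (_≤ twoDegSum G j) (sum-nbrConst c j) (sum-mono (nbrConst≤nbrDeg c j low))

    twoDeg-lower₁ : ∀ c {j v} → (∀ w → Adj G j w → c ≤ deg G w) → Adj G j v →
                    c * deg G j + deg G v ≤ twoDegSum G j + c
    twoDeg-lower₁ c {j} {v} low j~v =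
      subst₂ _≤_ (cong₂ _+_ (sum-nbrConst c j) (nbrDeg-at j~v)) (cong (twoDegSum G j +_) (nbrConst-at c j~v))
        (sum-le-exchange (nbrDeg j) (nbrConst c j) v (nbrConst≤nbrDeg c j low))

    twoDeg-lower₂ : ∀ c {j v w} → (∀ x → Adj G j x → c ≤ deg G x) → Adj G j v → Adj G j w → v ≢ w →
                    c * deg G j + deg G v + deg G w ≤ twoDegSum G j + c + c
    twoDeg-lower₂ c {j} {v} {w} low j~v j~w v≢w = begin
      c * deg G j + deg G v + deg G w  ≡⟨ cong (_+ deg G w) (sym split) ⟩
      sumF h + c + deg G w             ≡⟨ +-assoc (sumF h) c _ ⟩
      sumF h + (c + deg G w)           ≡⟨ cong (sumF h +_) (+-comm c _) ⟩
      sumF h + (deg G w + c)           ≡⟨ sym (+-assoc (sumF h) _ c) ⟩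
      sumF h + deg G w + c             ≡⟨ cong (λ x → sumF h + x + c) (sym (nbrDeg-at j~w)) ⟩
      sumF h + nbrDeg j w + c          ≤⟨ +-monoˡ-≤ c (sum-le-exchange (nbrDeg j) h w h≤) ⟩
      twoDegSum G j + h w + c          ≡⟨ cong (λ x → twoDegSum G j + x + c) hw≡c ⟩
      twoDegSum G j + c + c            ∎
      where
        open ≤-Reasoning
        h : Fin n → ℕ
        h = updateAt (nbrConst c j) v (const (deg G v))
        split : sumF h + c ≡ c * deg G j + deg G v
        split = trans (cong (sumF h +_) (sym (nbrConst-at c j~v)))
                      (trans (sum-update (nbrConst c j) v (deg G v)) (cong (_+ deg G v) (sum-nbrConst c j)))
        h≤ : ∀ x → h x ≤ nbrDeg j x
        h≤ x with x ≟ v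
        ... | yes refl = ≤-reflexive (trans (updateAt-updates v (nbrConst c j)) (sym (nbrDeg-at j~v)))
        ... | no  x≢v  = subst (_≤ nbrDeg j x) (sym (updateAt-minimal x v (nbrConst c j) x≢v))
                               (nbrConst≤nbrDeg c j low x)
        hw≡c : h w ≡ c
        hw≡c = trans (updateAt-minimal w v (nbrConst c j) (v≢w ∘ sym)) (nbrConst-at c j~w)

    twoDeg-constant : ∀ c j → (∀ w → Adj G j w → deg G w ≡ c) → twoDegSum G j ≡ c * deg G j
    twoDeg-constant c j all-c = trans (sum-cong same) (sum-nbrConst c j)
      where
        same : ∀ w → nbrDeg j w ≡ nbrConst c j w
        same w with adj G j w in j~w
        ... | true  = trans (all-c w j~w) (sym (*-identityʳ c))
        ... | false = sym (*-zeroʳ c)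

    twoDeg-leaves-but-one : ∀ j u → Adj G j u → (∀ w → Adj G j w → w ≢ u → deg G w ≡ 1) →
                            twoDegSum G j + 1 ≡ deg G j + deg G u
    twoDeg-leaves-but-one j u j~u leaves = begin
      twoDegSum G j + 1                    ≡⟨ cong (twoDegSum G j +_) (sym ([]-at j~u)) ⟩
      twoDegSum G j + [ adj G j u ]        ≡⟨ sum-exchange (nbrDeg j) (λ w → [ adj G j w ]) u same ⟩
      deg G j + nbrDeg j u                 ≡⟨ cong (deg G j +_) (nbrDeg-at j~u) ⟩
      deg G j + deg G u                    ∎
      where
        open ≡-Reasoning
        same : ∀ w → w ≢ u → nbrDeg j w ≡ [ adj G j w ]
        same w w≢u with adj G j w in j~w
        ... | true  = leaves w j~w w≢u
        ... | false = refl

    twoDeg-pendant : ∀ j u → Adj G j u → (∀ w → Adj G j w → w ≡ u) →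
                     twoDegSum G j ≡ deg G u × deg G j ≡ 1
    twoDeg-pendant j u j~u only-u =
      trans (sum-single (nbrDeg j) u off) (nbrDeg-at j~u) ,
      trans (sum-single (λ w → [ adj G j w ]) u off) ([]-at j~u)
      where
        off : ∀ {f : Fin n → ℕ} w → w ≢ u → (if adj G j w then f w else 0) ≡ 0
        off w w≢u with adj G j w in j~w
        ... | true  = ⊥-elim (w≢u (only-u w j~w))
        ... | false = refl

    other-neighbour : ∀ {w} j → 1 ≤ deg G w → deg G w ≢ 1 → Σ (Fin n) λ x → Adj G w x × x ≢ j
    other-neighbour {w} j deg≥1 deg≢1 with any? (λ x → (adj G w x Bool.≟ true) ×-dec ¬? (x ≟ j))
    ... | yes found = found
    ... | no  none  = ⊥-elim (deg≢1 (≤-antisym (subst (_≤ 1) (sym (sum-single _ j only-j)) ([]≤1 _)) deg≥1))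
      where
        only-j : ∀ x → x ≢ j → [ adj G w x ] ≡ 0
        only-j x x≢j with adj G w x in w~x
        ... | true  = ⊥-elim (none (x , w~x , x≢j))
        ... | false = refl

module DegreeBounds where

  open import Defs hiding (sym)
  open FiniteSums
  open Neighbourhoods
  open import Data.Nat using (ℕ; suc; _+_; _*_; _∸_; _≤_; _<_; _≤?_; s≤s; >-nonZero)
  open import Data.Nat.Properties hiding (_≟_)
  open import Data.Nat.Tactic.RingSolver using (solve-∀)
  open import Data.Fin using (Fin)
  open import Data.Fin.Properties using (_≟_; any?)
  open import Data.Bool using (true)
  import Data.Bool as Bool
  open import Data.Integer using (+_; +≤+)
  import Data.Integer.Properties as ℤ
  open import Data.Rational.Unnormalised using (mkℚᵘ; _≃_; *≤*; *≡*) renaming (_≤_ to _≤ℚ_)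
  open import Data.Product using (Σ; _×_; _,_; proj₁; proj₂)
  open import Function using (_∘_)
  open import Data.Sum using (_⊎_; inj₁; inj₂)
  open import Data.Empty using (⊥; ⊥-elim)
  open import Data.List using ([]; _∷_)
  open import Data.List.Relation.Unary.All using ([]; _∷_)
  open import Data.List.Relation.Unary.AllPairs using ([]; _∷_)
  open import Relation.Nullary using (yes; no; ¬_)
  open import Relation.Nullary.Decidable using (_×-dec_)
  open import Relation.Binary.PropositionalEquality

  -- The average 2-degree as integer arithmetic: for d_i ≥ 1 the denominator of
  -- m_i = S_i / d_i is d_i, so cross-multiplying turns m_i ≤ k into S_i ≤ k·d_i and
  -- m_i = k into S_i = k·d_i, where S_i = Σ_{j~i} d_j.
  module _ {n : ℕ} (G : Graph n) {i : Fin n} (deg≥1 : 1 ≤ deg G i) (k : ℕ) where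

    private
      denominator : suc (deg G i ∸ 1) ≡ deg G i
      denominator = m+[n∸m]≡n deg≥1

    avg≤⇒ : avg2deg G i ≤ℚ mkℚᵘ (+ k) 0 → twoDegSum G i ≤ k * deg G i
    avg≤⇒ (*≤* le) rewrite sym (ℤ.pos-* (twoDegSum G i) 1) | sym (ℤ.pos-* k (suc (deg G i ∸ 1))) with le
    ... | +≤+ le′ = subst₂ _≤_ (*-identityʳ _) (cong (k *_) denominator) le′

    avg≃⇒ : avg2deg G i ≃ mkℚᵘ (+ k) 0 → twoDegSum G i ≡ k * deg G i
    avg≃⇒ (*≡* eq) rewrite sym (ℤ.pos-* (twoDegSum G i) 1) | sym (ℤ.pos-* k (suc (deg G i ∸ 1))) =
      subst₂ _≡_ (*-identityʳ _) (cong (k *_) denominator) (ℤ.+-injective eq)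

    avg≃⇐ : twoDegSum G i ≡ k * deg G i → avg2deg G i ≃ mkℚᵘ (+ k) 0
    avg≃⇐ eq = *≡* (trans (sym (ℤ.pos-* (twoDegSum G i) 1))
                    (trans (cong +_ eq′) (ℤ.pos-* k (suc (deg G i ∸ 1)))))
      where eq′ = trans (*-identityʳ _) (trans eq (cong (k *_) (sym denominator)))

  -- Write k = m + 1 and A = m·k + 1 = k² − k + 1.  If Σ_{j~i} d_j ≤ k·d_i
  -- for every vertex, then adjacent p, v satisfy d_v ≤ m·d_p + 1, and every vertex has a
  -- neighbour of degree ≤ k; together these give Δ(G) ≤ A.
  module DegreeBound (m : ℕ) {n : ℕ} (G : Graph n) (noIso : NoIsolated G)
                     (twoDeg≤ : ∀ i → twoDegSum G i ≤ suc m * deg G i) where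

    k A : ℕ
    k = suc m
    A = m * k + 1

    -- Adjacent p, v satisfy d_v ≤ m·d_p + 1: compare  d_p + d_v ≤ S_p + 1  with S_p ≤ k·d_p.
    nbr-deg-bound : ∀ {p v} → Adj G p v → deg G v ≤ m * deg G p + 1
    nbr-deg-bound {p} {v} p~v = +-cancelˡ-≤ (deg G p) _ _ (begin
      deg G p + deg G v          ≡⟨ cong (_+ deg G v) (sym (*-identityˡ _)) ⟩
      1 * deg G p + deg G v      ≤⟨ twoDeg-lower₁ G 1 (λ w _ → noIso w) p~v ⟩
      twoDegSum G p + 1          ≤⟨ +-monoˡ-≤ 1 (twoDeg≤ p) ⟩
      k * deg G p + 1            ≡⟨ +-assoc (deg G p) (m * deg G p) 1 ⟩
      deg G p + (m * deg G p + 1) ∎)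
      where open ≤-Reasoning

    -- Every vertex has a neighbour of degree ≤ k: otherwise (k + 1)·d_v ≤ S_v ≤ k·d_v.
    small-neighbour : ∀ v → Σ (Fin n) λ j → Adj G v j × deg G j ≤ k
    small-neighbour v with any? (λ j → (adj G v j Bool.≟ true) ×-dec (deg G j ≤? k))
    ... | yes found = found
    ... | no none = ⊥-elim (<⇒≱ (*-monoˡ-< (deg G v) {{>-nonZero (noIso v)}} (n<1+n k))
                                 (≤-trans (twoDeg-lower G (suc k) v big) (twoDeg≤ v)))
      where
        big : ∀ w → Adj G v w → suc k ≤ deg G w
        big w v~w with deg G w ≤? k
        ... | yes small = ⊥-elim (none (w , v~w , small))
        ... | no  large = ≰⇒> large

    deg-bound : ∀ v → deg G v ≤ A
    deg-bound v with small-neighbour v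
    ... | j , v~j , dj≤k = ≤-trans (nbr-deg-bound (Adj-sym G v~j)) (+-monoˡ-≤ 1 (*-monoʳ-≤ m dj≤k))

    maxDeg-bound : maxDeg G ≤ A
    maxDeg-bound = max-least (deg G) A deg-bound

  module Centred (t : ℕ) {n : ℕ} (G : Graph n) (conn : Connected G) (noIso : NoIsolated G)
                 (twoDeg≤ : ∀ i → twoDegSum G i ≤ suc (suc t) * deg G i)
                 (v : Fin n) (deg-v : deg G v ≡ suc t * suc (suc t) + 1) where

    m : ℕ
    m = suc t

    open DegreeBound m G noIso twoDeg≤ public

    -- d_v = A ≤ m·d_p + 1 forces d_p ≥ k; then k·d_v + d_p ≤ Σ_{w~v} d_w + k forces d_p ≤ k.
    spoke-deg : ∀ {p} → Adj G v p → deg G p ≡ k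
    spoke-deg {p} v~p = ≤-antisym upper (lower v~p)
      where
        lower : ∀ {p} → Adj G v p → k ≤ deg G p
        lower {p} v~p = *-cancelˡ-≤ m (+-cancelʳ-≤ 1 (m * k) (m * deg G p)
                          (subst (_≤ m * deg G p + 1) deg-v (nbr-deg-bound (Adj-sym G v~p))))
        upper : deg G p ≤ k
        upper = +-cancelˡ-≤ (k * deg G v) _ _ (≤-trans (twoDeg-lower₁ G k (λ w → lower) v~p)
                                                        (+-monoˡ-≤ k (twoDeg≤ v)))

    -- For a spoke p:  d_p + d_v + d_w ≤ Σ_{x~p} d_x + 2 ≤ k² + 2 leaves no room for d_w > 1.
    tip-deg : ∀ {p w} → Adj G v p → Adj G p w → w ≢ v → deg G w ≡ 1
    tip-deg {p} {w} v~p p~w w≢v = ≤-antisym (room m (deg G w) bound) (noIso w)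
      where
        room : ∀ m d → 1 * suc m + (m * suc m + 1) + d ≤ suc m * suc m + 1 + 1 → d ≤ 1
        room m d le = +-cancelˡ-≤ (suc m * suc m + 1) d 1 (subst (_≤ suc m * suc m + 1 + 1) (shape m d) le)
          where shape : ∀ m d → 1 * suc m + (m * suc m + 1) + d ≡ suc m * suc m + 1 + d
                shape = solve-∀
        bound : 1 * k + A + deg G w ≤ k * k + 1 + 1
        bound = subst₂ (λ dp dv → 1 * dp + dv + deg G w ≤ k * dp + 1 + 1) (spoke-deg v~p) deg-v
                  (≤-trans (twoDeg-lower₂ G 1 (λ x _ → noIso x) (Adj-sym G v~p) p~w (w≢v ∘ sym))
                           (+-monoˡ-≤ 1 (+-monoˡ-≤ 1 (twoDeg≤ p))))

    k≢1 : k ≢ 1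
    k≢1 ()

    -- Two spokes are never adjacent: a neighbour of a spoke other than v has degree 1 ≠ k.
    tip-not-spoke : ∀ {p w} → Adj G v p → Adj G p w → w ≢ v → ¬ Adj G v w
    tip-not-spoke v~p p~w w≢v v~w = k≢1 (trans (sym (spoke-deg v~w)) (tip-deg v~p p~w w≢v))

    data Position (w : Fin n) : Set where
      centre : w ≡ v → Position w
      spoke  : Adj G v w → Position w
      tip    : (p : Fin n) → Adj G v p → Adj G p w → w ≢ v → Position w

    position-step : ∀ {x y} → Adj G x y → Position x → Position y
    position-step x~y (centre refl) = spoke x~y
    position-step {x} {y} x~y (spoke v~x) with y ≟ v
    ... | yes y≡v = centre y≡v
    ... | no  y≢v = tip x v~x x~y y≢v
    position-step x~y (tip p v~p p~x x≢v) =
      spoke (subst (Adj G v) (deg1-unique G (tip-deg v~p p~x x≢v) (Adj-sym G p~x) x~y) v~p)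

    position : ∀ w → Position w
    position w = along (conn v w) (centre refl)
      where
        along : ∀ {x y} → Reachable G x y → Position x → Position y
        along here         pos = pos
        along (step x~z r) pos = along r (position-step x~z pos)

    harmonic : ∀ w → twoDegSum G w ≡ k * deg G w
    harmonic w with position w
    ... | centre refl = twoDeg-constant G k v (λ p → spoke-deg)
    ... | spoke v~w = +-cancelʳ-≡ 1 _ _ (begin
      twoDegSum G w + 1    ≡⟨ twoDeg-leaves-but-one G w v (Adj-sym G v~w) (λ x → tip-deg v~w) ⟩
      deg G w + deg G v    ≡⟨ cong₂ _+_ (spoke-deg v~w) deg-v ⟩
      k + (m * k + 1)      ≡⟨ sym (+-assoc k (m * k) 1) ⟩
      k * k + 1            ≡⟨ cong (λ d → k * d + 1) (sym (spoke-deg v~w)) ⟩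
      k * deg G w + 1      ∎)
      where open ≡-Reasoning
    ... | tip p v~p p~w w≢v = begin
      twoDegSum G w  ≡⟨ proj₁ pendant ⟩
      deg G p        ≡⟨ spoke-deg v~p ⟩
      k              ≡⟨ sym (*-identityʳ k) ⟩
      k * 1          ≡⟨ cong (k *_) (sym (proj₂ pendant)) ⟩
      k * deg G w    ∎
      where
        open ≡-Reasoning
        pendant : twoDegSum G w ≡ deg G p × deg G w ≡ 1
        pendant = twoDeg-pendant G w p (Adj-sym G p~w)
                    (λ y w~y → deg1-unique G (tip-deg v~p p~w w≢v) w~y (Adj-sym G p~w))

    -- d_v = A > k.
    not-regular : ¬ Regular G k
    not-regular regular = <⇒≢ (k<A t) (trans (sym (regular v)) deg-v)
      where
        k<A : ∀ t → suc (suc t) < suc t * suc (suc t) + 1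
        k<A t = ≤-trans (s≤s (m≤m+n (suc (suc t)) (t * suc (suc t)))) (≤-reflexive (+-comm 1 _))

    -- A non-backtracking walk y₀ y₁ y₂ y₃ visits the centre at y₁ or y₂: an inner vertex
    -- has two distinct neighbours, so it is not a tip, and a spoke's other neighbours are tips.
    through-centre : ∀ {y₀ y₁ y₂ y₃} → Adj G y₀ y₁ → Adj G y₁ y₂ → Adj G y₂ y₃ →
                     y₀ ≢ y₂ → y₁ ≢ y₃ → y₁ ≡ v ⊎ y₂ ≡ v
    through-centre {y₁ = y₁} {y₂} a₀₁ a₁₂ a₂₃ y₀≢y₂ y₁≢y₃ with position y₁ | y₂ ≟ v
    ... | centre y₁≡v         | _         = inj₁ y₁≡v
    ... | _                   | yes y₂≡v  = inj₂ y₂≡v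
    ... | tip p v~p p~y₁ y₁≢v | no _      = ⊥-elim (<⇒≢ (deg≥2 G (Adj-sym G a₀₁) a₁₂ y₀≢y₂) (sym (tip-deg v~p p~y₁ y₁≢v)))
    ... | spoke v~y₁          | no y₂≢v   = ⊥-elim (<⇒≢ (deg≥2 G (Adj-sym G a₁₂) a₂₃ y₁≢y₃) (sym (tip-deg v~y₁ a₁₂ y₂≢v)))

    -- Hence no non-backtracking walk has five edges: the windows (y₁,y₂), (y₂,y₃), (y₃,y₄)
    -- would each contain v, putting v at two positions at distance 1 or 2.
    no-long-walk : ∀ {y₀ y₁ y₂ y₃ y₄ y₅} →
                   Adj G y₀ y₁ → Adj G y₁ y₂ → Adj G y₂ y₃ → Adj G y₃ y₄ → Adj G y₄ y₅ →
                   y₀ ≢ y₂ → y₁ ≢ y₃ → y₂ ≢ y₄ → y₃ ≢ y₅ → ⊥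
    no-long-walk a₀₁ a₁₂ a₂₃ a₃₄ a₄₅ n₀₂ n₁₃ n₂₄ n₃₅
      with through-centre a₀₁ a₁₂ a₂₃ n₀₂ n₁₃ | through-centre a₁₂ a₂₃ a₃₄ n₁₃ n₂₄ | through-centre a₂₃ a₃₄ a₄₅ n₂₄ n₃₅
    ... | inj₁ y₁≡v | inj₁ y₂≡v | _         = Adj⇒≢ G a₁₂ (trans y₁≡v (sym y₂≡v))
    ... | inj₁ y₁≡v | inj₂ y₃≡v | _         = n₁₃ (trans y₁≡v (sym y₃≡v))
    ... | inj₂ y₂≡v | _         | inj₁ y₃≡v = Adj⇒≢ G a₂₃ (trans y₂≡v (sym y₃≡v))
    ... | inj₂ y₂≡v | _         | inj₂ y₄≡v = n₂₄ (trans y₂≡v (sym y₄≡v))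

    -- Going around a cycle (repeating it if it is short) gives such a walk.
    acyclic : Acyclic G
    acyclic (x , [] , () , _)
    acyclic (x , _ ∷ [] , s≤s () , _)
    acyclic (x , v₁ ∷ v₂ ∷ [] , _ , (x≢v₁ ∷ x≢v₂ ∷ []) ∷ (v₁≢v₂ ∷ []) ∷ _ , (a₀₁ , a₁₂ , a₂₀ , _)) =
      no-long-walk a₀₁ a₁₂ a₂₀ a₀₁ a₁₂ x≢v₂ (≢-sym x≢v₁) (≢-sym v₁≢v₂) x≢v₂
    acyclic (x , v₁ ∷ v₂ ∷ v₃ ∷ [] , _ , (_ ∷ x≢v₂ ∷ _) ∷ (_ ∷ v₁≢v₃ ∷ []) ∷ _ , (a₀₁ , a₁₂ , a₂₃ , a₃₀ , _)) =
      no-long-walk a₀₁ a₁₂ a₂₃ a₃₀ a₀₁ x≢v₂ v₁≢v₃ (≢-sym x≢v₂) (≢-sym v₁≢v₃)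
    acyclic (x , v₁ ∷ v₂ ∷ v₃ ∷ v₄ ∷ [] , _ , (_ ∷ x≢v₂ ∷ x≢v₃ ∷ _) ∷ (_ ∷ v₁≢v₃ ∷ _) ∷ (_ ∷ v₂≢v₄ ∷ _) ∷ _ ,
             (a₀₁ , a₁₂ , a₂₃ , a₃₄ , a₄₀ , _)) =
      no-long-walk a₀₁ a₁₂ a₂₃ a₃₄ a₄₀ x≢v₂ v₁≢v₃ v₂≢v₄ (≢-sym x≢v₃)
    acyclic (x , v₁ ∷ v₂ ∷ v₃ ∷ v₄ ∷ v₅ ∷ _ , _ , (_ ∷ x≢v₂ ∷ _) ∷ (_ ∷ v₁≢v₃ ∷ _) ∷ (_ ∷ v₂≢v₄ ∷ _) ∷ (_ ∷ v₃≢v₅ ∷ _) ∷ _ ,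
             (a₀₁ , a₁₂ , a₂₃ , a₃₄ , a₄₅ , _)) =
      no-long-walk a₀₁ a₁₂ a₂₃ a₃₄ a₄₅ x≢v₂ v₁≢v₃ v₂≢v₄ v₃≢v₅

module TreeTk where

  open import Defs using (TkRel; TkAdj; TkOrder; sumF)
  open FiniteSums
  open import Data.Nat using (ℕ; suc; _+_; _*_; _∸_; _^_; _≤_; _<_; _≡ᵇ_; _≤ᵇ_; _<ᵇ_; NonZero)
  open import Data.Nat.DivMod using (_%_; m<n⇒m%n≡m; [m+kn]%n≡m%n)
  open import Data.Nat.Properties hiding (_≟_)
  open import Data.Nat.Tactic.RingSolver using (solve-∀)
  open import Data.Bool using (Bool; T; _∧_; _∨_)
  open import Data.Bool.Properties using (T-∧; T-∨)
  open import Data.Fin using (Fin; toℕ)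
  open import Data.Fin.Properties using (toℕ-injective)
  open import Data.Product using (_×_; _,_)
  import Data.Product as Product
  open import Data.Sum using (_⊎_)
  import Data.Sum as Sum
  open import Data.Empty using (⊥-elim)
  open import Function using (_∘_)
  open import Function.Bundles using (_⇔_; mk⇔; Equivalence)
  open import Relation.Binary.Definitions using (tri<; tri≈; tri>)
  open import Relation.Binary.PropositionalEquality hiding ([_])

  -- Throughout, k = m + 1 and A = m·k + 1 = k² − k + 1.  (Powers are written out as
  -- products in the ring-solver lemmas; the two forms are definitionally equal.)
  A-formula : ∀ m → suc m ^ 2 ∸ suc m + 1 ≡ m * suc m + 1
  A-formula m = cong (_+ 1) (trans (cong (_∸ suc m) (square m)) (m+n∸n≡m (m * suc m) (suc m)))
    where square : ∀ m → suc m * (suc m * 1) ≡ m * suc m + suc m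
          square = solve-∀

  Tk-order : ∀ m → TkOrder (suc m) ≡ suc (suc m * (m * suc m + 1))
  Tk-order m = begin
    suc m ^ 3 ∸ suc m ^ 2 + suc m + 1                     ≡⟨ cong (λ x → x ∸ suc m ^ 2 + suc m + 1) (cube m) ⟩
    m * suc m * suc m + suc m ^ 2 ∸ suc m ^ 2 + suc m + 1 ≡⟨ cong (λ x → x + suc m + 1) (m+n∸n≡m _ (suc m ^ 2)) ⟩
    m * suc m * suc m + suc m + 1                         ≡⟨ expand m ⟩
    suc (suc m * (m * suc m + 1))                         ∎
    where
      open ≡-Reasoning
      cube : ∀ m → suc m * (suc m * (suc m * 1)) ≡ m * suc m * suc m + suc m * (suc m * 1)
      cube = solve-∀
      expand : ∀ m → m * suc m * suc m + suc m + 1 ≡ suc (suc m * (m * suc m + 1))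
      expand = solve-∀

  TkEdge : (A m x y : ℕ) → Set
  TkEdge A m x y = (x ≡ 0 × 1 ≤ y × y ≤ A)
                 ⊎ (1 ≤ x × x ≤ A × A + 1 + (x ∸ 1) * m ≤ y × y < A + 1 + x * m)

  private
    Rel : (A m x y : ℕ) → Bool
    Rel A m x y = ((x ≡ᵇ 0) ∧ (1 ≤ᵇ y) ∧ (y ≤ᵇ A))
                ∨ ((1 ≤ᵇ x) ∧ (x ≤ᵇ A) ∧ (A + 1 + (x ∸ 1) * m ≤ᵇ y) ∧ (y <ᵇ A + 1 + x * m))

    T-Rel : ∀ A m x y → T (Rel A m x y) ⇔ TkEdge A m x y
    T-Rel A m x y = mk⇔ to from
      where
        to : T (Rel A m x y) → TkEdge A m x y
        to r = Sum.map
          (λ h → let (h₀ , h′) = Equivalence.to T-∧ h ; (h₁ , h₂) = Equivalence.to T-∧ h′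
                 in ≡ᵇ⇒≡ x 0 h₀ , ≤ᵇ⇒≤ 1 y h₁ , ≤ᵇ⇒≤ y A h₂)
          (λ h → let (h₀ , h′) = Equivalence.to T-∧ h ; (h₁ , h″) = Equivalence.to T-∧ h′
                     (h₂ , h₃) = Equivalence.to T-∧ h″
                 in ≤ᵇ⇒≤ 1 x h₀ , ≤ᵇ⇒≤ x A h₁ , ≤ᵇ⇒≤ _ y h₂ , <ᵇ⇒< y _ h₃)
          (Equivalence.to T-∨ r)
        from : TkEdge A m x y → T (Rel A m x y)
        from e = Equivalence.from T-∨ (Sum.map
          (λ (h₀ , h₁ , h₂) → Equivalence.from T-∧ (≡⇒≡ᵇ x 0 h₀ , Equivalence.from T-∧ (≤⇒≤ᵇ h₁ , ≤⇒≤ᵇ h₂)))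
          (λ (h₀ , h₁ , h₂ , h₃) → Equivalence.from T-∧ (≤⇒≤ᵇ h₀ , Equivalence.from T-∧ (≤⇒≤ᵇ h₁ ,
                                     Equivalence.from T-∧ (≤⇒≤ᵇ h₂ , <⇒<ᵇ h₃))))
          e)

  T-TkRel : ∀ m x y → T (TkRel (suc m) x y) ⇔ TkEdge (m * suc m + 1) m x y
  T-TkRel m x y = subst (λ A → T (Rel A m x y) ⇔ TkEdge (m * suc m + 1) m x y) (sym (A-formula m))
                        (T-Rel (m * suc m + 1) m x y)

  T-TkAdj : ∀ m (x y : Fin (TkOrder (suc m))) →
            T (TkAdj (suc m) x y) ⇔ (TkEdge (m * suc m + 1) m (toℕ x) (toℕ y) ⊎ TkEdge (m * suc m + 1) m (toℕ y) (toℕ x))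
  T-TkAdj m x y = mk⇔
    (Sum.map (Equivalence.to (T-TkRel m _ _)) (Equivalence.to (T-TkRel m _ _)) ∘ Equivalence.to T-∨)
    (Equivalence.from T-∨ ∘ Sum.map (Equivalence.from (T-TkRel m _ _)) (Equivalence.from (T-TkRel m _ _)))

  digits-unique : ∀ {m r r′ s s′} .{{_ : NonZero m}} → s < m → s′ < m →
                  r * m + s ≡ r′ * m + s′ → r ≡ r′ × s ≡ s′
  digits-unique {m} {r} {r′} {s} {s′} s<m s′<m eq = r≡r′ , s≡s′
    where
      open ≡-Reasoning
      s≡s′ : s ≡ s′
      s≡s′ = begin
        s                 ≡⟨ sym (m<n⇒m%n≡m s<m) ⟩
        s % m             ≡⟨ sym ([m+kn]%n≡m%n s r m) ⟩
        (s + r * m) % m   ≡⟨ cong (_% m) (trans (+-comm s _) (trans eq (+-comm _ s′))) ⟩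
        (s′ + r′ * m) % m ≡⟨ [m+kn]%n≡m%n s′ r′ m ⟩
        s′ % m            ≡⟨ m<n⇒m%n≡m s′<m ⟩
        s′                ∎
      r≡r′ : r ≡ r′
      r≡r′ = *-cancelʳ-≡ r r′ m (+-cancelʳ-≡ s _ _ (trans eq (cong (r′ * m +_) (sym s≡s′))))

  window : ∀ {m r q s} → s < m → r * m ≤ q * m + s → q * m + s < suc r * m → r ≡ q
  window {m} {r} {q} {s} s<m low high with <-cmp r q
  ... | tri≈ _ r≡q _ = r≡q
  ... | tri< r<q _ _ = ⊥-elim (<⇒≱ high (≤-trans (*-monoˡ-≤ m r<q) (m≤m+n (q * m) s)))
  ... | tri> _ _ q<r = ⊥-elim (<⇒≱ (+-monoʳ-< (q * m) s<m)
                               (≤-trans (≤-reflexive (+-comm (q * m) m)) (≤-trans (*-monoˡ-≤ m q<r) low)))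

  -- Ranks: rank P w = #{u | P u, u < w} numbers the vertices satisfying P as
  -- 0, 1, …, count P − 1 without repetition.
  module Ranking {n : ℕ} (P : Fin n → Bool) where

    below : Fin n → Fin n → ℕ
    below w u = [ P u ∧ (toℕ u <ᵇ toℕ w) ]

    rank : Fin n → ℕ
    rank w = sumF (below w)

    count : ℕ
    count = sumF (λ u → [ P u ])

    private
      below-self : ∀ w → below w w ≡ 0
      below-self w = []-false (λ h → <-irrefl refl (<ᵇ⇒< (toℕ w) (toℕ w) (Product.proj₂ (Equivalence.to T-∧ h))))

      below-mono : ∀ {w w′} → toℕ w ≤ toℕ w′ → ∀ u → below w u ≤ below w′ u
      below-mono w≤w′ u = []-mono (λ h → let (Pu , u<w) = Equivalence.to T-∧ h in
        Equivalence.from T-∧ (Pu , <⇒<ᵇ (<-≤-trans (<ᵇ⇒< _ _ u<w) w≤w′)))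

      below≤P : ∀ w u → below w u ≤ [ P u ]
      below≤P w u = []-mono (Product.proj₁ ∘ Equivalence.to T-∧)

    rank-< : ∀ {w w′} → T (P w) → toℕ w < toℕ w′ → suc (rank w) ≤ rank w′
    rank-< {w} {w′} Pw w<w′ = subst₂ _≤_
      (trans (cong (rank w +_) ([]-true (Equivalence.from T-∧ (Pw , <⇒<ᵇ w<w′)))) (+-comm _ 1))
      (trans (cong (rank w′ +_) (below-self w)) (+-identityʳ _))
      (sum-le-exchange (below w′) (below w) w (below-mono (<⇒≤ w<w′)))

    rank<count : ∀ {w} → T (P w) → suc (rank w) ≤ count
    rank<count {w} Pw = subst₂ _≤_
      (trans (cong (rank w +_) ([]-true Pw)) (+-comm _ 1))
      (trans (cong (count +_) (below-self w)) (+-identityʳ _))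
      (sum-le-exchange (λ u → [ P u ]) (below w) w (below≤P w))

    rank-injective : ∀ {w w′} → T (P w) → T (P w′) → rank w ≡ rank w′ → w ≡ w′
    rank-injective {w} {w′} Pw Pw′ same with <-cmp (toℕ w) (toℕ w′)
    ... | tri≈ _ w≡w′ _ = toℕ-injective w≡w′
    ... | tri< w<w′ _ _ = ⊥-elim (<⇒≢ (rank-< Pw w<w′) same)
    ... | tri> _ _ w′<w = ⊥-elim (<⇒≢ (rank-< Pw′ w′<w) (sym same))

module IsomorphismToTk where

  open import Defs hiding (sym)
  open FiniteSums
  open Neighbourhoods
  open DegreeBounds
  open TreeTk
  open import Data.Nat using (ℕ; suc; _+_; _*_; _≤_; _<_; z≤n; s≤s)
  open import Data.Nat.Properties hiding (_≟_)
  open import Data.Fin using (Fin; toℕ; fromℕ<)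
  open import Data.Fin.Properties using (_≟_; toℕ-fromℕ<)
  open import Data.Bool using (Bool; true; false; T; _∧_; not)
  open import Data.Bool.Properties using (T-≡; ⇔→≡)
  open import Data.Product using (_×_; _,_; proj₂)
  open import Data.Sum using (_⊎_; inj₁; inj₂)
  import Data.Sum as Sum
  open import Data.Empty using (⊥-elim)
  open import Function using (_∘_)
  open import Function.Definitions using (Injective)
  open import Function.Bundles using (_⇔_; mk⇔; Equivalence)
  open import Relation.Nullary using (yes; no; ¬_; does)
  open import Relation.Nullary.Decidable using (dec-true; dec-false)
  open import Relation.Binary.PropositionalEquality hiding ([_])

  -- If G is connected, Σ_{j~i} d_j ≤ k·d_i everywhere and d_v = A, then G ≅ T_k: number
  -- the centre 0, the spokes 1 … A, and the tips of the (r+1)-st spoke A + 1 + r·m, …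
  module Isomorphism (t : ℕ) {n : ℕ} (G : Graph n) (conn : Connected G) (noIso : NoIsolated G)
                     (twoDeg≤ : ∀ i → twoDegSum G i ≤ suc (suc t) * deg G i)
                     (v : Fin n) (deg-v : deg G v ≡ suc t * suc (suc t) + 1) where

    open Centred t G conn noIso twoDeg≤ v deg-v

    tipOf : Fin n → Fin n → Bool
    tipOf p u = adj G p u ∧ not (does (u ≟ v))

    tipOf-intro : ∀ {p u} → Adj G p u → u ≢ v → T (tipOf p u)
    tipOf-intro {p} {u} p~u u≢v with u ≟ v
    ... | yes u≡v = ⊥-elim (u≢v u≡v)
    ... | no  _   rewrite p~u = _

    tipOf-elim : ∀ {p u} → T (tipOf p u) → Adj G p u × u ≢ v
    tipOf-elim {p} {u} h with adj G p u | u ≟ v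
    ... | true | no u≢v = refl , u≢v

    open Ranking (adj G v) using () renaming (rank to spokeRank; rank<count to spokeRank<count;
                                              rank-injective to spokeRank-injective)
    module Tips (p : Fin n) = Ranking (tipOf p)
    open Tips using () renaming (rank to tipRank)

    -- A spoke p has d_p = k = m + 1 neighbours, namely v and m tips.
    tip-count : ∀ {p} → Adj G v p → Tips.count p ≡ m
    tip-count {p} v~p = suc-injective (begin
      suc (Tips.count p)                    ≡⟨ +-comm 1 _ ⟩
      Tips.count p + 1                      ≡⟨ cong (Tips.count p +_) (sym ([]-at G (Adj-sym G v~p))) ⟩
      Tips.count p + [ adj G p v ]          ≡⟨ sum-exchange (λ u → [ tipOf p u ]) (λ u → [ adj G p u ]) v agree ⟩
      deg G p + [ tipOf p v ]               ≡⟨ cong (deg G p +_) ([]-false (λ h → proj₂ (tipOf-elim h) refl)) ⟩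
      deg G p + 0                           ≡⟨ trans (+-identityʳ _) (spoke-deg v~p) ⟩
      k                                     ∎)
      where
        open ≡-Reasoning
        agree : ∀ u → u ≢ v → [ tipOf p u ] ≡ [ adj G p u ]
        agree u u≢v with u ≟ v
        ... | yes u≡v = ⊥-elim (u≢v u≡v)
        ... | no  _   with adj G p u
        ...   | true  = refl
        ...   | false = refl

    spokeRank<A : ∀ {p} → Adj G v p → suc (spokeRank p) ≤ A
    spokeRank<A {p} v~p = subst (suc (spokeRank p) ≤_) deg-v (spokeRank<count (Equivalence.from T-≡ v~p))

    tipRank<m : ∀ {p w} → Adj G v p → Adj G p w → w ≢ v → tipRank p w < m
    tipRank<m {p} {w} v~p p~w w≢v = subst (suc (tipRank p w) ≤_) (tip-count v~p) (Tips.rank<count p (tipOf-intro p~w w≢v))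

    tipCode : Fin n → Fin n → ℕ
    tipCode p w = A + 1 + spokeRank p * m + tipRank p w

    code : ∀ {w} → Position w → ℕ
    code         (centre _)      = 0
    code {w}     (spoke _)       = suc (spokeRank w)
    code {w}     (tip p _ _ _)   = tipCode p w

    tipCode-digits : ∀ p w → tipCode p w ≡ (A + 1) + (spokeRank p * m + tipRank p w)
    tipCode-digits p w = +-assoc (A + 1) _ _

    above-A : ∀ x → A < A + 1 + x
    above-A x = subst (_≤ A + 1 + x) (+-comm A 1) (m≤m+n (A + 1) x)

    A<tipCode : ∀ p w → A < tipCode p w
    A<tipCode p w = subst (A <_) (sym (tipCode-digits p w)) (above-A _)

    -- Distinct vertices get distinct numbers: the ranges of the three kinds are
    -- disjoint, ranks are injective, and base-m digits are unique.
    code-injective : ∀ {i j} (pᵢ : Position i) (pⱼ : Position j) → code pᵢ ≡ code pⱼ → i ≡ j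
    code-injective (centre i≡v) (centre j≡v) _ = trans i≡v (sym j≡v)
    code-injective (centre _) (spoke _) ()
    code-injective (spoke _) (centre _) ()
    code-injective {j = j} (centre _) (tip q _ _ _) eq = ⊥-elim (<⇒≢ (≤-<-trans z≤n (A<tipCode q j)) eq)
    code-injective {i} (tip p _ _ _) (centre _) eq = ⊥-elim (<⇒≢ (≤-<-trans z≤n (A<tipCode p i)) (sym eq))
    code-injective (spoke v~i) (spoke v~j) eq =
      spokeRank-injective (Equivalence.from T-≡ v~i) (Equivalence.from T-≡ v~j) (suc-injective eq)
    code-injective {j = j} (spoke v~i) (tip q _ _ _) eq =
      ⊥-elim (<⇒≢ (≤-<-trans (spokeRank<A v~i) (A<tipCode q j)) eq)
    code-injective {i} (tip p _ _ _) (spoke v~j) eq =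
      ⊥-elim (<⇒≢ (≤-<-trans (spokeRank<A v~j) (A<tipCode p i)) (sym eq))
    code-injective {i} {j} (tip p v~p p~i i≢v) (tip q v~q q~j j≢v) eq
      with digits-unique (tipRank<m v~p p~i i≢v) (tipRank<m v~q q~j j≢v)
             (+-cancelˡ-≡ (A + 1) _ _ (trans (sym (tipCode-digits p i)) (trans eq (tipCode-digits q j))))
    ... | same-spoke , same-tip with spokeRank-injective (Equivalence.from T-≡ v~p) (Equivalence.from T-≡ v~q) same-spoke
    ...   | refl = Tips.rank-injective p (tipOf-intro p~i i≢v) (tipOf-intro q~j j≢v) same-tip

    -- All numbers are below |T_k| = 1 + k·A: a tip number is A + 1 + (r·m + s) with
    -- r < A, s < m, so r·m + s < A·m.
    code-bound : ∀ {w} (pos : Position w) → code pos < suc (k * A)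
    code-bound (centre _)  = s≤s z≤n
    code-bound (spoke v~w) = s≤s (≤-trans (spokeRank<A v~w) (m≤m+n A (m * A)))
    code-bound {w} (tip p v~p p~w w≢v) = s≤s (begin
      tipCode p w                   ≡⟨ tipCode-digits p w ⟩
      A + 1 + (r * m + s)           ≡⟨ +-assoc A 1 _ ⟩
      A + suc (r * m + s)           ≤⟨ +-monoʳ-≤ A digits<mA ⟩
      A + m * A                     ∎)
      where
        open ≤-Reasoning
        r s : ℕ
        r = spokeRank p
        s = tipRank p w
        digits<mA : r * m + s < m * A
        digits<mA = begin-strict
          r * m + s   <⟨ +-monoʳ-< (r * m) (tipRank<m v~p p~w w≢v) ⟩
          r * m + m   ≡⟨ +-comm (r * m) m ⟩
          suc r * m   ≤⟨ *-monoˡ-≤ m (spokeRank<A v~p) ⟩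
          A * m       ≡⟨ *-comm A m ⟩
          m * A       ∎

    Edge : ℕ → ℕ → Set
    Edge = TkEdge A m

    spoke-tip-edge : ∀ {p w} → Adj G v p → Adj G p w → w ≢ v → Edge (suc (spokeRank p)) (tipCode p w)
    spoke-tip-edge {p} {w} v~p p~w w≢v =
      inj₂ (s≤s z≤n , spokeRank<A v~p , m≤m+n _ _ , (begin-strict
        A + 1 + r * m + s    <⟨ +-monoʳ-< (A + 1 + r * m) (tipRank<m v~p p~w w≢v) ⟩
        A + 1 + r * m + m    ≡⟨ +-assoc (A + 1) (r * m) m ⟩
        A + 1 + (r * m + m)  ≡⟨ cong (A + 1 +_) (+-comm (r * m) m) ⟩
        A + 1 + suc r * m    ∎))
      where
        open ≤-Reasoning
        r s : ℕ
        r = spokeRank p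
        s = tipRank p w

    adj⇒edge : ∀ {i j} (pᵢ : Position i) (pⱼ : Position j) → Adj G i j →
               Edge (code pᵢ) (code pⱼ) ⊎ Edge (code pⱼ) (code pᵢ)
    adj⇒edge (centre i≡v) (centre j≡v) i~j = ⊥-elim (Adj⇒≢ G i~j (trans i≡v (sym j≡v)))
    adj⇒edge (centre refl) (spoke v~j) _ = inj₁ (inj₁ (refl , s≤s z≤n , spokeRank<A v~j))
    adj⇒edge (spoke v~i) (centre refl) _ = inj₂ (inj₁ (refl , s≤s z≤n , spokeRank<A v~i))
    adj⇒edge (centre refl) (tip q v~q q~j j≢v) v~j = ⊥-elim (tip-not-spoke v~q q~j j≢v v~j)
    adj⇒edge (tip p v~p p~i i≢v) (centre refl) i~v = ⊥-elim (tip-not-spoke v~p p~i i≢v (Adj-sym G i~v))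
    adj⇒edge (spoke v~i) (spoke v~j) i~j = ⊥-elim (tip-not-spoke v~i i~j (Adj⇒≢ G v~j ∘ sym) v~j)
    adj⇒edge (spoke v~i) (tip q v~q q~j j≢v) i~j
      with deg1-unique G (tip-deg v~q q~j j≢v) (Adj-sym G i~j) (Adj-sym G q~j)
    ... | refl = inj₁ (spoke-tip-edge v~q q~j j≢v)
    adj⇒edge (tip p v~p p~i i≢v) (spoke v~j) i~j
      with deg1-unique G (tip-deg v~p p~i i≢v) i~j (Adj-sym G p~i)
    ... | refl = inj₂ (spoke-tip-edge v~p p~i i≢v)
    adj⇒edge (tip p v~p p~i i≢v) (tip q v~q q~j j≢v) i~j
      with deg1-unique G (tip-deg v~p p~i i≢v) i~j (Adj-sym G p~i)
    ... | refl = ⊥-elim (tip-not-spoke v~q q~j j≢v v~p)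

    edge⇒adj : ∀ {i j} (pᵢ : Position i) (pⱼ : Position j) → Edge (code pᵢ) (code pⱼ) → Adj G i j
    edge⇒adj (centre _) (centre _) (inj₁ (_ , () , _))
    edge⇒adj (centre refl) (spoke v~j) _ = v~j
    edge⇒adj {j = j} (centre _) (tip q _ _ _) (inj₁ (_ , _ , y≤A)) = ⊥-elim (<⇒≱ (A<tipCode q j) y≤A)
    edge⇒adj (spoke _) _ (inj₁ (() , _))
    edge⇒adj {i} (tip p _ _ _) _ (inj₁ (x≡0 , _)) = ⊥-elim (<⇒≢ (≤-<-trans z≤n (A<tipCode p i)) (sym x≡0))
    edge⇒adj (centre _) _ (inj₂ (() , _))
    edge⇒adj {i} (tip p _ _ _) _ (inj₂ (_ , x≤A , _)) = ⊥-elim (<⇒≱ (A<tipCode p i) x≤A)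
    edge⇒adj (spoke _) (centre _) (inj₂ (_ , _ , low , _)) = ⊥-elim (<⇒≱ (≤-<-trans z≤n (above-A _)) low)
    edge⇒adj (spoke _) (spoke v~j) (inj₂ (_ , _ , low , _)) =
      ⊥-elim (<⇒≱ (above-A _) (≤-trans low (spokeRank<A v~j)))
    edge⇒adj {i} {j} (spoke v~i) (tip q v~q q~j j≢v) (inj₂ (_ , _ , low , high))
      with spokeRank-injective (Equivalence.from T-≡ v~i) (Equivalence.from T-≡ v~q)
             (window (tipRank<m v~q q~j j≢v)
                (+-cancelˡ-≤ (A + 1) _ _ (subst (A + 1 + spokeRank i * m ≤_) (tipCode-digits q j) low))
                (+-cancelˡ-≤ (A + 1) _ _ (subst (_≤ A + 1 + suc (spokeRank i) * m)
                                           (trans (cong suc (tipCode-digits q j)) (sym (+-suc (A + 1) _))) high)))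
    ... | refl = q~j

    -- Counting vertices.  Every w satisfies  [w = v] + [v ~ w] + #{p | v ~ p ~ w} = 1 + [w = v]·A;
    -- summing over w, with k·A walks v ~ p ~ w in total, gives  1 + A + k·A = n + A.
    isCentre : Fin n → ℕ
    isCentre w = [ does (w ≟ v) ]

    walks : Fin n → ℕ
    walks w = sumF (λ p → [ adj G v p ] * [ adj G p w ])

    isCentre-v : isCentre v ≡ 1
    isCentre-v = cong [_] (dec-true (v ≟ v) refl)

    isCentre-≢ : ∀ {w} → w ≢ v → isCentre w ≡ 0
    isCentre-≢ {w} w≢v = cong [_] (dec-false (w ≟ v) w≢v)

    walks-to : ∀ {w} → Position w → isCentre w + [ adj G v w ] + walks w ≡ 1 + isCentre w * A
    walks-to (centre refl) = begin
      isCentre v + [ adj G v v ] + walks v  ≡⟨ cong₂ (λ c a → c + [ a ] + walks v) isCentre-v (Defs.Graph.irrefl G v) ⟩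
      1 + walks v                           ≡⟨ cong suc (trans (sum-cong back) deg-v) ⟩
      1 + A                                 ≡⟨ cong suc (sym (*-identityˡ A)) ⟩
      1 + 1 * A                             ≡⟨ cong (λ c → 1 + c * A) (sym isCentre-v) ⟩
      1 + isCentre v * A                    ∎
      where
        open ≡-Reasoning
        back : ∀ p → [ adj G v p ] * [ adj G p v ] ≡ [ adj G v p ]
        back p rewrite Defs.Graph.sym G p v with adj G v p
        ... | true  = refl
        ... | false = refl
    walks-to {w} (spoke v~w) = begin
      isCentre w + [ adj G v w ] + walks w  ≡⟨ cong₂ (λ c a → c + a + walks w) (isCentre-≢ w≢v) ([]-at G v~w) ⟩
      1 + walks w                           ≡⟨ cong suc (trans (sum-cong none) (sum-zeros {n})) ⟩
      1                                     ≡⟨ cong (λ c → 1 + c * A) (sym (isCentre-≢ w≢v)) ⟩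
      1 + isCentre w * A                    ∎
      where
        open ≡-Reasoning
        w≢v : w ≢ v
        w≢v = Adj⇒≢ G v~w ∘ sym
        none : ∀ p → [ adj G v p ] * [ adj G p w ] ≡ 0
        none p with adj G v p in v~p | adj G p w in p~w
        ... | true  | true  = ⊥-elim (tip-not-spoke v~p p~w w≢v v~w)
        ... | true  | false = refl
        ... | false | _     = refl
    walks-to {w} (tip q v~q q~w w≢v) = begin
      isCentre w + [ adj G v w ] + walks w
        ≡⟨ cong₂ (λ c a → c + [ a ] + walks w) (isCentre-≢ w≢v) (¬Adj⇒false G (tip-not-spoke v~q q~w w≢v)) ⟩
      walks w                                ≡⟨ sum-single _ q only-q ⟩
      [ adj G v q ] * [ adj G q w ]          ≡⟨ cong₂ (λ a b → [ a ] * [ b ]) v~q q~w ⟩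
      1                                      ≡⟨ cong (λ c → 1 + c * A) (sym (isCentre-≢ w≢v)) ⟩
      1 + isCentre w * A                     ∎
      where
        open ≡-Reasoning
        only-q : ∀ p → p ≢ q → [ adj G v p ] * [ adj G p w ] ≡ 0
        only-q p p≢q with adj G v p in v~p | adj G p w in p~w
        ... | true  | true  = ⊥-elim (p≢q (deg1-unique G (tip-deg v~q q~w w≢v) (Adj-sym G p~w) (Adj-sym G q~w)))
        ... | true  | false = refl
        ... | false | _     = refl

    walks-total : sumF walks ≡ k * A
    walks-total = begin
      sumF (λ w → sumF (λ p → [ adj G v p ] * [ adj G p w ]))  ≡⟨ sum-comm (λ w p → [ adj G v p ] * [ adj G p w ]) ⟩
      sumF (λ p → sumF (λ w → [ adj G v p ] * [ adj G p w ]))  ≡⟨ sum-cong per-spoke ⟩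
      sumF (λ p → k * [ adj G v p ])                          ≡⟨ sum-scale k (λ p → [ adj G v p ]) ⟩
      k * deg G v                                             ≡⟨ cong (k *_) deg-v ⟩
      k * A                                                   ∎
      where
        open ≡-Reasoning
        per-spoke : ∀ p → sumF (λ w → [ adj G v p ] * [ adj G p w ]) ≡ k * [ adj G v p ]
        per-spoke p with adj G v p in v~p
        ... | true  = trans (sum-scale 1 (λ w → [ adj G p w ])) (trans (*-identityˡ _) (trans (spoke-deg v~p) (sym (*-identityʳ k))))
        ... | false = trans (sum-scale 0 (λ w → [ adj G p w ])) (sym (*-zeroʳ k))

    vertex-count : n ≡ suc (k * A)
    vertex-count = +-cancelʳ-≡ A n (suc (k * A)) (begin
      n + A                                                ≡⟨ cong₂ _+_ (sym (sum-ones {n})) (sym centre-once) ⟩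
      sumF {n} (λ _ → 1) + sumF (λ w → isCentre w * A)     ≡⟨ sym (sum-+ (λ _ → 1) (λ w → isCentre w * A)) ⟩
      sumF (λ w → 1 + isCentre w * A)                      ≡⟨ sum-cong (λ w → sym (walks-to (position w))) ⟩
      sumF (λ w → isCentre w + [ adj G v w ] + walks w)    ≡⟨ sum-+ (λ w → isCentre w + [ adj G v w ]) walks ⟩
      sumF (λ w → isCentre w + [ adj G v w ]) + sumF walks ≡⟨ cong (_+ sumF walks) (sum-+ isCentre (λ w → [ adj G v w ])) ⟩
      sumF isCentre + deg G v + sumF walks                 ≡⟨ cong₂ (λ c d → c + d + sumF walks) centre-sum deg-v ⟩
      1 + A + sumF walks                                   ≡⟨ cong (1 + A +_) walks-total ⟩
      1 + A + k * A                                        ≡⟨ cong suc (+-comm A (k * A)) ⟩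
      suc (k * A) + A                                      ∎)
      where
        open ≡-Reasoning
        centre-sum : sumF isCentre ≡ 1
        centre-sum = trans (sum-single isCentre v (λ w → isCentre-≢)) isCentre-v
        centre-once : sumF (λ w → isCentre w * A) ≡ A
        centre-once = begin
          sumF (λ w → isCentre w * A)  ≡⟨ sum-cong (λ w → *-comm (isCentre w) A) ⟩
          sumF (λ w → A * isCentre w)  ≡⟨ sum-scale A isCentre ⟩
          A * sumF isCentre            ≡⟨ cong (A *_) centre-sum ⟩
          A * 1                        ≡⟨ *-identityʳ A ⟩
          A                            ∎

    number : Fin n → Fin (TkOrder k)
    number w = fromℕ< (subst (code (position w) <_) (sym (Tk-order m)) (code-bound (position w)))

    toℕ-number : ∀ w → toℕ (number w) ≡ code (position w)
    toℕ-number w = toℕ-fromℕ< _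

    number-injective : Injective _≡_ _≡_ number
    number-injective {i} {j} eq =
      code-injective (position i) (position j) (trans (sym (toℕ-number i)) (trans (cong toℕ eq) (toℕ-number j)))

    number-adj : ∀ i j → adj G i j ≡ TkAdj k (number i) (number j)
    number-adj i j = ⇔→≡ {z = true} (mk⇔ (Equivalence.to T-≡ ∘ to) (from ∘ Equivalence.from T-≡))
      where
        Edges : ℕ → ℕ → Set
        Edges a b = Edge a b ⊎ Edge b a
        to : Adj G i j → T (TkAdj k (number i) (number j))
        to i~j = Equivalence.from (T-TkAdj m (number i) (number j))
                   (subst₂ Edges (sym (toℕ-number i)) (sym (toℕ-number j)) (adj⇒edge (position i) (position j) i~j))
        from : T (TkAdj k (number i) (number j)) → Adj G i j
        from h = Sum.[ edge⇒adj (position i) (position j) , Adj-sym G ∘ edge⇒adj (position j) (position i) ]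
                   (subst₂ Edges (toℕ-number i) (toℕ-number j) (Equivalence.to (T-TkAdj m (number i) (number j)) h))

    isTk : IsTk k G
    isTk = number , (number-injective , injective⇒surjective (trans vertex-count (sym (Tk-order m))) number number-injective)
                  , number-adj

module LongestPath where

  open import Defs hiding (sym)
  open FiniteSums
  open Neighbourhoods
  open import Data.Nat using (ℕ; zero; suc; _+_; _≤_; _<_; z≤n; s≤s)
  open import Data.Nat.Properties using (≤-trans; ≤-refl; <⇒≱; n≤1+n; +-suc; +-identityʳ; ≤-reflexive; +-monoˡ-≤)
  import Data.Nat as ℕ
  open import Data.Fin using (Fin) renaming (zero to fzero; suc to fsuc)
  open import Data.Fin.Properties using (_≟_; any?; injective⇒≤)
  open import Data.Bool using (true)
  import Data.Bool as Bool
  open import Data.List using (List; []; _∷_; _++_; length; lookup)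
  open import Data.List.Relation.Unary.All as All using (All; []; _∷_)
  open import Data.List.Relation.Unary.All.Properties using (¬Any⇒All¬)
  open import Data.List.Relation.Unary.Any using (here; there)
  open import Data.List.Relation.Unary.AllPairs using ([]; _∷_)
  open import Data.List.Relation.Unary.Unique.Propositional using (Unique)
  open import Data.List.Membership.Propositional using (_∈_; _∉_)
  open import Data.List.Membership.Propositional.Properties using (∈-lookup)
  open import Data.Product using (Σ; _×_; _,_; proj₁; proj₂)
  open import Data.Sum using (_⊎_; inj₁; inj₂)
  open import Data.Empty using (⊥-elim)
  open import Data.Unit using (tt)
  open import Function using (_∘_)
  open import Function.Definitions using (Injective)
  open import Relation.Nullary using (yes; no; ¬_)
  open import Relation.Nullary.Decidable using (_×-dec_; ¬?)
  open import Relation.Binary.PropositionalEquality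

  -- A list of distinct vertices has at most n entries, as 'lookup' injects its positions.
  lookup-injective : ∀ {A : Set} {xs : List A} → Unique xs → Injective _≡_ _≡_ (lookup xs)
  lookup-injective {xs = _ ∷ _} _          {fzero}  {fzero}  _  = refl
  lookup-injective {xs = _ ∷ _} (x∉xs ∷ _) {fzero}  {fsuc j} eq = ⊥-elim (All.lookup x∉xs (∈-lookup j) eq)
  lookup-injective {xs = _ ∷ _} (x∉xs ∷ _) {fsuc i} {fzero}  eq = ⊥-elim (All.lookup x∉xs (∈-lookup i) (sym eq))
  lookup-injective {xs = _ ∷ _} (_ ∷ u)    {fsuc i} {fsuc j} eq = cong fsuc (lookup-injective u eq)

  unique-length : ∀ {n} {xs : List (Fin n)} → Unique xs → length xs ≤ n
  unique-length u = injective⇒≤ (lookup-injective u)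

  prefix : ∀ {A : Set} {w : A} {xs : List A} → w ∈ xs → List A
  prefix {xs = x ∷ _} (here _)  = x ∷ []
  prefix {xs = x ∷ _} (there p) = x ∷ prefix p

  prefix-All : ∀ {A : Set} {P : A → Set} {w : A} {xs : List A} (p : w ∈ xs) → All P xs → All P (prefix p)
  prefix-All (here _)  (px ∷ _)   = px ∷ []
  prefix-All (there p) (px ∷ pxs) = px ∷ prefix-All p pxs

  prefix-Unique : ∀ {A : Set} {w : A} {xs : List A} (p : w ∈ xs) → Unique xs → Unique (prefix p)
  prefix-Unique (here _)  (_ ∷ _)      = [] ∷ []
  prefix-Unique (there p) (x∉xs ∷ u)   = prefix-All p x∉xs ∷ prefix-Unique p u

  prefix-nonempty : ∀ {A : Set} {w : A} {xs : List A} (p : w ∈ xs) → 1 ≤ length (prefix p)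
  prefix-nonempty (here _)  = s≤s z≤n
  prefix-nonempty (there p) = s≤s z≤n

  module _ {n : ℕ} (G : Graph n) where

    IsPath : List (Fin n) → Set
    IsPath xs = Unique xs × Chain G xs

    prefix-Chain : ∀ {x w e l} (p : w ∈ l) → Chain G (x ∷ l) → Adj G w e → Chain G (x ∷ prefix p ++ e ∷ [])
    prefix-Chain {l = _ ∷ _}     (here refl) (x~y , _) w~e = x~y , w~e , tt
    prefix-Chain {l = _ ∷ _ ∷ _} (there p)   (x~y , c) w~e = x~y , prefix-Chain p c w~e

    close-cycle : ∀ {e y w l} → IsPath (e ∷ y ∷ l) → w ∈ l → Adj G w e → HasCycle G
    close-cycle (((e≢y ∷ e∉l) ∷ (y∉l ∷ ul)) , (e~y , c)) p w~e =
      _ , (_ ∷ prefix p) , s≤s (prefix-nonempty p) ,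
      ((e≢y ∷ prefix-All p e∉l) ∷ (prefix-All p y∉l ∷ prefix-Unique p ul)) ,
      (e~y , prefix-Chain p c w~e)

    record Twig : Set where
      field
        j u e   : Fin n
        j~u     : Adj G j u
        leaves  : ∀ w → Adj G j w → w ≢ u → deg G w ≡ 1
        e~j     : Adj G e j
        e-only  : ∀ w → Adj G e w → w ≡ j

    module Longest (noIso : NoIsolated G) (acyclic : Acyclic G) where

      open import Data.List.Membership.DecPropositional (_≟_ {n}) using (_∈?_)

      no-chord : ∀ {e y w l} → IsPath (e ∷ y ∷ l) → Adj G e w → w ∉ l
      no-chord P e~w w∈l = acyclic (close-cycle P w∈l (Adj-sym G e~w))

      fresh : ∀ {e y w l} → IsPath (e ∷ y ∷ l) → Adj G e w → w ≢ y → w ∉ (e ∷ y ∷ l)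
      fresh P e~w w≢y (here w≡e)          = Adj⇒≢ G e~w (sym w≡e)
      fresh P e~w w≢y (there (here w≡y))  = w≢y w≡y
      fresh P e~w w≢y (there (there w∈l)) = no-chord P e~w w∈l

      extend : ∀ {e y w l} → IsPath (e ∷ y ∷ l) → Adj G e w → w ≢ y → IsPath (w ∷ e ∷ y ∷ l)
      extend P@(u , c) e~w w≢y = (¬Any⇒All¬ _ (fresh P e~w w≢y) ∷ u) , (Adj-sym G e~w , c)

      -- A path  e ∷ j ∷ rest  that cannot be lengthened at its end e gives a twig at j,
      -- with u the next vertex of the path (or e itself if there is none).
      twig-at : ∀ e j rest → IsPath (e ∷ j ∷ rest) → (∀ w → Adj G e w → w ≡ j) →
                (∀ w → Adj G j w → w ∉ (e ∷ j ∷ rest) → deg G w ≡ 1) → Twig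
      twig-at e j [] ((_ ∷ _) , (e~j , _)) e-only outside-leaves =
        record { j = j ; u = e ; e = e ; j~u = Adj-sym G e~j ; e~j = e~j ; e-only = e-only ; leaves = leaves }
        where
          leaves : ∀ w → Adj G j w → w ≢ e → deg G w ≡ 1
          leaves w j~w w≢e = outside-leaves w j~w λ
            { (here w≡e)         → w≢e w≡e
            ; (there (here w≡j)) → Adj⇒≢ G j~w (sym w≡j) }
      twig-at e j (x ∷ rest) ((_ ∷ Pⱼ) , (e~j , cⱼ)) e-only outside-leaves =
        record { j = j ; u = x ; e = e ; j~u = proj₁ cⱼ ; e~j = e~j ; e-only = e-only ; leaves = leaves }
        where
          leaves : ∀ w → Adj G j w → w ≢ x → deg G w ≡ 1
          leaves w j~w w≢x with w ≟ e
          ... | yes refl = proj₂ (twoDeg-pendant G e j e~j e-only)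
          ... | no  w≢e  = outside-leaves w j~w λ
            { (here w≡e)                 → w≢e w≡e
            ; (there (here w≡j))         → Adj⇒≢ G j~w (sym w≡j)
            ; (there (there (here w≡x))) → w≢x w≡x
            ; (there (there (there p)))  → no-chord (Pⱼ , cⱼ) j~w p }

      Longer : ℕ → Set
      Longer L = Σ (Fin n) λ e → Σ (Fin n) λ j → Σ (List (Fin n)) λ rest → IsPath (e ∷ j ∷ rest) × L < length rest

      -- Either the path  e ∷ j ∷ rest  can be lengthened (by a new neighbour of e, or by
      -- replacing e with a path w′ ∷ w through a non-leaf neighbour w of j), or it ends in a twig.
      lengthen-or-twig : ∀ e j rest → IsPath (e ∷ j ∷ rest) → Longer (length rest) ⊎ Twig
      lengthen-or-twig e j rest P@((_ ∷ uⱼ) , (_ , cⱼ)) with any? (λ w → (adj G e w Bool.≟ true) ×-dec ¬? (w ≟ j))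
      ... | yes (w , e~w , w≢j) = inj₁ (w , e , j ∷ rest , extend P e~w w≢j , ≤-refl)
      ... | no no-other = second-step
        where
          e-only : ∀ w → Adj G e w → w ≡ j
          e-only w e~w with w ≟ j
          ... | yes w≡j = w≡j
          ... | no  w≢j = ⊥-elim (no-other (w , e~w , w≢j))
          through : ∀ w → Adj G j w → w ∉ (e ∷ j ∷ rest) → deg G w ≢ 1 → Longer (length rest)
          through w j~w w∉ deg≢1 with other-neighbour G j (noIso w) deg≢1
          ... | w′ , w~w′ , w′≢j = w′ , w , j ∷ rest , extend Pw w~w′ w′≢j , ≤-refl
            where
              Pw : IsPath (w ∷ j ∷ rest)
              Pw = (¬Any⇒All¬ _ (w∉ ∘ there) ∷ uⱼ) , (Adj-sym G j~w , cⱼ)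
          second-step : Longer (length rest) ⊎ Twig
          second-step with any? (λ w → (adj G j w Bool.≟ true) ×-dec (¬? (w ∈? (e ∷ j ∷ rest)) ×-dec ¬? (deg G w ℕ.≟ 1)))
          ... | yes (w , j~w , w∉ , deg≢1) = inj₁ (through w j~w w∉ deg≢1)
          ... | no no-big = inj₂ (twig-at e j rest P e-only outside-leaves)
            where
              outside-leaves : ∀ w → Adj G j w → w ∉ (e ∷ j ∷ rest) → deg G w ≡ 1
              outside-leaves w j~w w∉ with deg G w ℕ.≟ 1
              ... | yes deg≡1 = deg≡1
              ... | no  deg≢1 = ⊥-elim (no-big (w , j~w , w∉ , deg≢1))

      -- Paths have at most n vertices, so lengthening must stop.
      search : ∀ fuel e j rest → IsPath (e ∷ j ∷ rest) → n ≤ length rest + fuel → Twig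
      search fuel e j rest P bound with lengthen-or-twig e j rest P
      ... | inj₂ twig = twig
      ... | inj₁ (e′ , j′ , rest′ , P′ , longer) with fuel
      ...   | zero   = ⊥-elim (<⇒≱ (≤-trans longer path-fits) (≤-trans bound (≤-reflexive (+-identityʳ _))))
        where path-fits : length rest′ ≤ n
              path-fits = ≤-trans (n≤1+n _) (≤-trans (n≤1+n _) (unique-length (proj₁ P′)))
      ...   | suc f  = search f e′ j′ rest′ P′
                         (≤-trans bound (≤-trans (≤-reflexive (+-suc (length rest) f)) (+-monoˡ-≤ f longer)))

      twig : Fin n → Twig
      twig x with neighbour G x (noIso x)
      ... | e , x~e = search n e x [] (((Adj⇒≢ G x~e ∘ sym) ∷ []) ∷ ([] ∷ []) , (Adj-sym G x~e , tt)) ≤-refl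

open import Defs
open FiniteSums
open Neighbourhoods
open DegreeBounds
open TreeTk
open IsomorphismToTk
open LongestPath
open import Data.Nat using (ℕ; zero; suc; _+_; _*_; _∸_; _^_; _≤_; _<_; z≤n; s≤s)
open import Data.Nat.Properties using (≤-antisym; ≤-trans; ≤-reflexive; +-cancelˡ-≡; *-cancelˡ-≡; *-identityʳ; *-identityˡ; +-assoc; m≤n+m; m≤m+n; suc-injective)
open import Data.Fin using (Fin; toℕ; fromℕ<) renaming (zero to fzero)
open import Data.Fin.Properties using (_≟_; toℕ-fromℕ<; toℕ-injective; toℕ<n; fromℕ<-injective)
open import Data.Bool using (true)
open import Data.Bool.Properties using (T-≡)
open import Data.Integer using (+_)
open import Data.Rational.Unnormalised using (mkℚᵘ; _≃_) renaming (_≤_ to _≤ℚ_)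
open import Data.Product using (Σ; _×_; _,_; proj₁; proj₂)
open import Data.Sum using (inj₁)
open import Data.Empty using (⊥-elim)
open import Function using (_∘_)
open import Function.Bundles using (_⇔_; mk⇔; Equivalence)
open import Relation.Nullary using (yes; no)
open import Relation.Binary.PropositionalEquality hiding ([_]) renaming (sym to ≡-sym)

TwigCondition : ℕ → ∀ {n} → Graph n → Set
TwigCondition k {n} G = Σ (Fin n) λ j → (deg G j ≡ k) × (avg2deg G j ≃ mkℚᵘ (+ k) 0) ×
                          Σ (Fin n) λ u → Adj G j u × (deg G u ≢ 1) ×
                            (∀ w → Adj G j w → w ≢ u → deg G w ≡ 1)

-- The root of T_k has degree A; hence a graph isomorphic to T_k has a vertex of degree ≥ A:
-- the preimages of the spokes 1, …, A are distinct neighbours of the preimage of the root.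
Tk-root : ∀ m {n} (G : Graph n) → IsTk (suc m) G → Σ (Fin n) λ r → m * suc m + 1 ≤ deg G r
Tk-root m {n} G (f , (f-inj , f-surj) , f-adj) = r , A≤deg
  where
    A N : ℕ
    A = m * suc m + 1
    N = TkOrder (suc m)
    preimage : Fin N → Fin n
    preimage y = proj₁ (f-surj y)
    f-preimage : ∀ y → f (preimage y) ≡ y
    f-preimage y = proj₂ (f-surj y) refl
    root : Fin N
    root = fromℕ< {0} (subst (0 <_) (≡-sym (Tk-order m)) (s≤s z≤n))
    spokeVertex : Fin A → Fin N
    spokeVertex x = fromℕ< (subst (suc (toℕ x) <_) (≡-sym (Tk-order m)) (s≤s (≤-trans (toℕ<n x) (m≤m+n A (m * A)))))
    r : Fin n
    r = preimage root
    spoke : Fin A → Fin n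
    spoke = preimage ∘ spokeVertex
    preimage-injective : ∀ {y y′} → preimage y ≡ preimage y′ → y ≡ y′
    preimage-injective {y} {y′} eq = trans (≡-sym (f-preimage y)) (trans (cong f eq) (f-preimage y′))
    spoke-injective : ∀ {x y} → spoke x ≡ spoke y → x ≡ y
    spoke-injective {x} {y} eq =
      toℕ-injective (suc-injective (fromℕ<-injective _ _ _ _ (preimage-injective eq)))
    r~spoke : ∀ x → adj G r (spoke x) ≡ true
    r~spoke x = trans (f-adj r (spoke x)) (trans (cong₂ (TkAdj (suc m)) (f-preimage root) (f-preimage (spokeVertex x)))
                  (Equivalence.to T-≡ (Equivalence.from (T-TkAdj m root (spokeVertex x))
                    (inj₁ (subst₂ (TkEdge A m) (≡-sym (toℕ-fromℕ< _)) (≡-sym (toℕ-fromℕ< _))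
                            (inj₁ (refl , s≤s z≤n , toℕ<n x)))))))
    A≤deg : A ≤ deg G r
    A≤deg = subst (_≤ deg G r) (trans (sum-cong (λ x → cong [_] (r~spoke x))) (sum-ones {A}))
                  (sum-injective spoke spoke-injective (λ w → [ adj G r w ]))

-- (iii) ⇒ (iv):  a twig j, with pendant neighbour e, of a pseudo k-regular tree.
-- Harmonicity at e gives d_j = m_e = k; if u were a leaf as well, m_j would be 1 ≠ k.
tree⇒twig : ∀ t {n} (G : Graph n) → NoIsolated G →
            IsTree G × PseudoRegular G (suc (suc t)) → TwigCondition (suc (suc t)) G
tree⇒twig t {zero}  G noIso (_ , _ , not-regular) = ⊥-elim (not-regular (λ ()))
tree⇒twig t {suc n} G noIso ((_ , acyclic) , harmonic , _) =
  j , deg-j , harmonic j , u , j~u , deg-u≢1 , leaves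
  where
    open Longest G noIso acyclic using (twig)
    open Twig (twig fzero)
    k : ℕ
    k = suc (suc t)
    twoDeg-harmonic : ∀ i → twoDegSum G i ≡ k * deg G i
    twoDeg-harmonic i = avg≃⇒ G (noIso i) k (harmonic i)
    pendant : twoDegSum G e ≡ deg G j × deg G e ≡ 1
    pendant = twoDeg-pendant G e j e~j e-only
    deg-j : deg G j ≡ k
    deg-j = begin
      deg G j          ≡⟨ ≡-sym (proj₁ pendant) ⟩
      twoDegSum G e    ≡⟨ twoDeg-harmonic e ⟩
      k * deg G e      ≡⟨ cong (k *_) (proj₂ pendant) ⟩
      k * 1            ≡⟨ *-identityʳ k ⟩
      k                ∎
      where open ≡-Reasoning
    deg-u≢1 : deg G u ≢ 1
    deg-u≢1 deg-u≡1 with *-cancelˡ-≡ k 1 k (begin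
      k * k            ≡⟨ cong (k *_) (≡-sym deg-j) ⟩
      k * deg G j      ≡⟨ ≡-sym (twoDeg-harmonic j) ⟩
      twoDegSum G j    ≡⟨ twoDeg-constant G 1 j all-leaves ⟩
      1 * deg G j      ≡⟨ trans (*-identityˡ _) deg-j ⟩
      k                ≡⟨ ≡-sym (*-identityʳ k) ⟩
      k * 1            ∎)
      where
        open ≡-Reasoning
        all-leaves : ∀ w → Adj G j w → deg G w ≡ 1
        all-leaves w j~w with w ≟ u
        ... | yes refl = deg-u≡1
        ... | no  w≢u  = leaves w j~w w≢u
    ... | ()

module Extremality (t : ℕ) {n : ℕ} (G : Graph n) (conn : Connected G) (noIso : NoIsolated G)
                   (avg≤k : ∀ i → avg2deg G i ≤ℚ mkℚᵘ (+ suc (suc t)) 0) where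

  twoDeg≤ : ∀ i → twoDegSum G i ≤ suc (suc t) * deg G i
  twoDeg≤ i = avg≤⇒ G (noIso i) (suc (suc t)) (avg≤k i)

  open DegreeBound (suc t) G noIso twoDeg≤ public using (k; A; maxDeg-bound)

  centre : maxDeg G ≡ A → Σ (Fin n) λ v → deg G v ≡ A
  centre max≡A with max-attained (deg G) (subst (1 ≤_) (≡-sym max≡A) (m≤n+m 1 (suc t * k)))
  ... | v , max≡dv = v , trans (≡-sym max≡dv) max≡A

  max⇒Tk : maxDeg G ≡ A → IsTk k G
  max⇒Tk max≡A = let (v , deg-v) = centre max≡A in Isomorphism.isTk t G conn noIso twoDeg≤ v deg-v

  max⇒tree : maxDeg G ≡ A → IsTree G × PseudoRegular G k
  max⇒tree max≡A = (conn , acyclic) , (λ i → avg≃⇐ G (noIso i) k (harmonic i)) , not-regular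
    where open Centred t G conn noIso twoDeg≤ (proj₁ (centre max≡A)) (proj₂ (centre max≡A))
            using (acyclic; harmonic; not-regular)

  attains : ∀ {v} → A ≤ deg G v → maxDeg G ≡ A
  attains {v} A≤dv = ≤-antisym maxDeg-bound (≤-trans A≤dv (max-upper (deg G) v))

  Tk⇒max : IsTk k G → maxDeg G ≡ A
  Tk⇒max iso = attains (proj₂ (Tk-root (suc t) G iso))

  -- (iv) ⇒ (i):  Σ_{w~j} d_w = k² and all but u are leaves, so d_u = k² − k + 1.
  twig⇒max : TwigCondition k G → maxDeg G ≡ A
  twig⇒max (j , deg-j , harmonic-j , u , j~u , _ , leaves) = attains (≤-reflexive (≡-sym deg-u))
    where
      open ≡-Reasoning
      deg-u : deg G u ≡ A
      deg-u = +-cancelˡ-≡ k _ _ (begin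
        k + deg G u            ≡⟨ cong (_+ deg G u) (≡-sym deg-j) ⟩
        deg G j + deg G u      ≡⟨ ≡-sym (twoDeg-leaves-but-one G j u j~u leaves) ⟩
        twoDegSum G j + 1      ≡⟨ cong (_+ 1) (trans (avg≃⇒ G (noIso j) k harmonic-j) (cong (k *_) deg-j)) ⟩
        k * k + 1              ≡⟨ +-assoc k (suc t * k) 1 ⟩
        k + A                  ∎)

theorem4p7 : (k : ℕ) → 2 ≤ k → (n : ℕ) (G : Graph n) →
    Connected G → NoIsolated G →
    (∀ i → avg2deg G i ≤ℚ mkℚᵘ (+ k) 0) →
    (maxDeg G ≤ k ^ 2 ∸ k + 1)
    × ((maxDeg G ≡ k ^ 2 ∸ k + 1) ⇔ IsTk k G)
    × (IsTk k G ⇔ (IsTree G × PseudoRegular G k))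
    × ((IsTree G × PseudoRegular G k) ⇔
        Σ (Fin n) λ j → (deg G j ≡ k) × (avg2deg G j ≃ mkℚᵘ (+ k) 0) ×
          Σ (Fin n) λ u → Adj G j u × (deg G u ≢ 1) ×
            (∀ w → Adj G j w → w ≢ u → deg G w ≡ 1))
theorem4p7 (suc (suc t)) (s≤s (s≤s z≤n)) n G conn noIso avg≤k =
  subst (maxDeg G ≤_) (≡-sym A≡) maxDeg-bound ,
  mk⇔ (λ max≡ → max⇒Tk (trans max≡ A≡)) (λ iso → trans (Tk⇒max iso) (≡-sym A≡)) ,
  mk⇔ (max⇒tree ∘ Tk⇒max) (max⇒Tk ∘ twig⇒max ∘ tree⇒twig t G noIso) ,
  mk⇔ (tree⇒twig t G noIso) (max⇒tree ∘ twig⇒max)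
  where
    open Extremality t G conn noIso avg≤k
    A≡ : k ^ 2 ∸ k + 1 ≡ A
    A≡ = A-formula (suc t)
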